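{- Let $G_1,G_2$ be simple connected graphs, each with at least one edge, with $m_1=|E(G_1)|$, $m_2=|E(G_2)|$, and $G=G_1\oplus_vG_2$. Let $\mathscr L$ be a set of $l$ pairs of distinct vertices of $G_2$ that are not edges of $G$, and let $\widehat G_2$ be $G_2$ with the pairs of $\mathscr L$ added as edges. Set $A=\mu(\widehat G_2,v)-\mu(G_2,v)$, $B=\mathscr{K}(\widehat G_2)-\mu(G_2,v)$, $C=\mathscr{K}(\widehat G_2)-\mathscr{K}(G_2)$. If $$Am_1^2+((A+C)m_2+Bl)m_1+C(m_2^2+lm_2)>0,$$ then $\mathscr L$ is a Braess set of $G$.
   Context: For a connected graph $H$, effective resistance $r_H(i,j)=(e_i-e_j)^TL^\dagger(e_i-e_j)$ with $L^\dagger$ the Moore–Penrose pseudoinverse of the Laplacian. For connected $H$ with $m\ge1$ edges and degrees $d_i$, Kemeny's constant $\mathscr{K}(H)=\sum_j\pi_jm_{ij}$ for the simple random walk ($\pi_j=d_j/2m$, $m_{ij}$ expected hitting time, $m_{jj}=0$), equal to $\frac1{4m}\sum_{i,j}d_id_jr_H(i,j)$. Moment: $\mu(H,v)=\sum_id_ir_H(i,v)$. $G_1\oplus_vG_2$ is the 1-sum identifying a chosen vertex of $G_1$ with a chosen vertex of $G_2$ into the vertex $v$. A Braess set of a graph $G$ is a set of non-edges of $G$ such that adding all of them to $G$ strictly increases Kemeny's constant. -}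

module Defs where

open import Data.Bool using (Bool; true; false; _∧_; _∨_; if_then_else_)
open import Data.Nat as ℕ using (ℕ; zero; suc)
open import Data.Fin using (Fin; zero; suc; toℕ; splitAt; punchIn)
open import Data.Fin.Properties using (_≟_)
open import Data.Sum using (inj₁; inj₂)
open import Data.Maybe using (Maybe; just; nothing)
open import Data.Integer using (+_)
open import Data.Rational using (ℚ; 0ℚ; _+_; _*_; _-_; _/_)
open import Relation.Nullary using (yes; no)
open import Relation.Binary.PropositionalEquality using (_≡_)

Graph : ℕ → Set
Graph n = Fin n → Fin n → Bool

record IsSimple {n : ℕ} (G : Graph n) : Set where
  field
    symm    : ∀ i j → G i j ≡ G j i
    irrefl  : ∀ i → G i i ≡ false

data Reach {n : ℕ} (G : Graph n) : Fin n → Fin n → Set where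
  here : ∀ {i} → Reach G i i
  step : ∀ {i j k} → G i j ≡ true → Reach G j k → Reach G i k

Connected : {n : ℕ} → Graph n → Set
Connected {n} G = ∀ (i j : Fin n) → Reach G i j

Σℕ : {n : ℕ} → (Fin n → ℕ) → ℕ
Σℕ {zero}  f = 0
Σℕ {suc n} f = f zero ℕ.+ Σℕ (λ i → f (suc i))

Σℚ : {n : ℕ} → (Fin n → ℚ) → ℚ
Σℚ {zero}  f = 0ℚ
Σℚ {suc n} f = f zero + Σℚ (λ i → f (suc i))

ℕ→ℚ : ℕ → ℚ
ℕ→ℚ k = + k / 1

-- 1/k (with the junk value 0 at k = 0, never used below since m ≥ 1)
inv : ℕ → ℚ
inv zero    = 0ℚ
inv (suc k) = + 1 / suc k

b2ℕ : Bool → ℕ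
b2ℕ true  = 1
b2ℕ false = 0

degree : {n : ℕ} → Graph n → Fin n → ℕ
degree G i = Σℕ (λ j → b2ℕ (G i j))

edgeCount : {n : ℕ} → Graph n → ℕ
edgeCount G = Σℕ (λ i → Σℕ (λ j → b2ℕ (G i j ∧ (toℕ i ℕ.<ᵇ toℕ j))))

Mat : ℕ → Set
Mat n = Fin n → Fin n → ℚ

_⊗_ : {n : ℕ} → Mat n → Mat n → Mat n
(A ⊗ B) i j = Σℚ (λ k → A i k * B k j)

transpose : {n : ℕ} → Mat n → Mat n
transpose A i j = A j i

laplacian : {n : ℕ} → Graph n → Mat n
laplacian G i j with i ≟ j
... | yes _ = ℕ→ℚ (degree G i)
... | no  _ = if G i j then (0ℚ - ℕ→ℚ 1) else 0ℚ

-- X is the Moore–Penrose pseudoinverse of A (the four Penrose equations;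
-- the pseudoinverse is unique, so this pins X down)
record IsPseudoinverse {n : ℕ} (A X : Mat n) : Set where
  field
    p1 : (A ⊗ X) ⊗ A ≡ A
    p2 : (X ⊗ A) ⊗ X ≡ X
    p3 : transpose (A ⊗ X) ≡ A ⊗ X
    p4 : transpose (X ⊗ A) ≡ X ⊗ A

-- effective resistance r(i,j) = (e_i - e_j)ᵀ L† (e_i - e_j), computed from L† = X
resistance : {n : ℕ} → Mat n → Fin n → Fin n → ℚ
resistance X i j = ((X i i + X j j) - X i j) - X j i

moment : {n : ℕ} → Graph n → Mat n → Fin n → ℚ
moment H X v = Σℚ (λ i → ℕ→ℚ (degree H i) * resistance X i v)

kemeny : {n : ℕ} → Graph n → Mat n → ℚ
kemeny H X = inv (4 ℕ.* edgeCount H) *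
  Σℚ (λ i → Σℚ (λ j → (ℕ→ℚ (degree H i) * ℕ→ℚ (degree H j)) * resistance X i j))

-- G₁ ⊕ G₂ lives on Fin (n₁ + k): the first n₁ vertices are those
-- of G₁; vertex v₂ of G₂ is identified with v₁; the remaining k vertices of
-- G₂ (in order, skipping v₂, via punchIn v₂) are the last k vertices.

from₁ : {n₁ k : ℕ} → Fin (n₁ ℕ.+ k) → Maybe (Fin n₁)
from₁ {n₁} x with splitAt n₁ x
... | inj₁ a = just a
... | inj₂ _ = nothing

from₂ : {n₁ k : ℕ} → Fin n₁ → Fin (suc k) → Fin (n₁ ℕ.+ k) → Maybe (Fin (suc k))
from₂ {n₁} v₁ v₂ x with splitAt n₁ x
... | inj₂ b = just (punchIn v₂ b)
... | inj₁ a with a ≟ v₁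
...   | yes _ = just v₂
...   | no  _ = nothing

liftAdj : {m p : ℕ} → Graph m → (Fin p → Maybe (Fin m)) → Graph p
liftAdj H f x y with f x | f y
... | just a | just b = H a b
... | _      | _      = false

oneSum : {n₁ k : ℕ} → Graph n₁ → Fin n₁ → Graph (suc k) → Fin (suc k) → Graph (n₁ ℕ.+ k)
oneSum {n₁} {k} G₁ v₁ G₂ v₂ x y =
  liftAdj G₁ (from₁ {n₁} {k}) x y ∨ liftAdj G₂ (from₂ v₁ v₂) x y

addEdges : {n : ℕ} → Graph n → Graph n → Graph n
addEdges G S i j = G i j ∨ S i j

{-# OPTIONS --safe #-}
-- Write 4m·K(H) = Σ_{i,j} d_i d_j r(i,j) and let v be the cut vertex. An effective resistance is a
-- potential difference, and potentials of currents entering and leaving on one side of v are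
-- constant on the other side; hence r(x,y) = r(x,v) + r(v,y) for x, y on opposite sides, resistances
-- inside G₁ are the same in G and in Ĝ, and resistances inside G₂ are those of G₂. This gives
--   4(m₁+m₂)·K(G) = S₁ + 4m₂·K(G₂) + 2(2m₂·μ₁ + 2m₁·μ(G₂,v)),  S₁ = Σ_{a,a' ∈ G₁} d_a d_a' r(a,a'),
-- μ₁ = Σ_{a ∈ G₁} d_a r(a,v), and the same formula for Ĝ with G₂, m₂ replaced by Ĝ₂, m₂ + l.
-- Subtracting and clearing denominators,
--   16(m₁+m₂)(m₁+m₂+l)·(K(Ĝ) − K(G)) = 16·E + 4l·(4m₁μ₁ − S₁),
-- where E is the polynomial of the hypothesis; and 4m₁μ₁ − S₁ = 2pᵀLp ≥ 0 for the potential
-- p = Σ_a d_a L†(e_a − e_v).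
module Submission where

open import Defs
open import Algebra.Bundles using (CommutativeRing)
import Algebra.Properties.Semiring.Sum as SemiringSum
open import Data.Bool using (Bool; true; false; _∧_; _∨_; T)
open import Data.Bool.Properties using (∨-identityʳ)
open import Data.Empty using (⊥-elim)
open import Data.Fin using (Fin; zero; suc; toℕ; splitAt; punchIn; punchOut; _↑ˡ_; _↑ʳ_; join)
open import Data.Fin.Properties
  using (_≟_; splitAt-↑ˡ; splitAt-↑ʳ; join-splitAt; ↑ˡ-injective; ↑ʳ-injective; toℕ-injective;
         punchOut-cong; punchIn-punchOut; punchOut-punchIn; punchInᵢ≢i)
import Data.Integer as ℤ
import Data.Integer.Properties as ℤ
open import Data.Maybe using (Maybe; just; nothing)
open import Data.Nat as ℕ using (ℕ; zero; suc)
import Data.Nat.Properties as ℕ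
open import Data.Nat.Coprimality using (1-coprimeTo) renaming (sym to coprime-sym)
open import Data.Product using (Σ; _,_; _×_)
open import Data.Rational hiding (_≟_)
open import Data.Rational.Properties renaming (_≟_ to _≟ℚ_)
open import Algebra.Properties.Group +-0-group using (x∙y⁻¹≈ε⇒x≈y)
open import Data.Rational.Solver using (module +-*-Solver)
open import Data.Rational.Unnormalised using (mkℚᵘ; *≡*) renaming (_≃_ to _≃ᵘ_)
import Data.Rational.Unnormalised.Properties as ℚᵘ
open import Data.Sum using (_⊎_; inj₁; inj₂; [_,_]′)
open import Relation.Binary using (tri<; tri≈; tri>)
open import Relation.Binary.PropositionalEquality
open import Relation.Nullary using (¬_; yes; no)
open +-*-Solver

-- Finite sums over ℚ

module ∑ = SemiringSum (CommutativeRing.semiring +-*-commutativeRing)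

Σℚ≡sum : ∀ {n} (f : Fin n → ℚ) → Σℚ f ≡ ∑.sum f
Σℚ≡sum {zero}  f = refl
Σℚ≡sum {suc n} f = cong (f zero +_) (Σℚ≡sum (λ i → f (suc i)))

Σℚ-cong : ∀ {n} {f g : Fin n → ℚ} → (∀ i → f i ≡ g i) → Σℚ f ≡ Σℚ g
Σℚ-cong {f = f} {g} f≗g = trans (Σℚ≡sum f) (trans (∑.sum-cong-≗ f≗g) (sym (Σℚ≡sum g)))

Σℚ-distrib-+ : ∀ {n} (f g : Fin n → ℚ) → Σℚ (λ i → f i + g i) ≡ Σℚ f + Σℚ g
Σℚ-distrib-+ f g =
  trans (Σℚ≡sum (λ i → f i + g i)) (trans (∑.∑-distrib-+ f g) (sym (cong₂ _+_ (Σℚ≡sum f) (Σℚ≡sum g))))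

Σℚ-comm : ∀ {m n} (f : Fin m → Fin n → ℚ) →
  Σℚ (λ i → Σℚ (λ j → f i j)) ≡ Σℚ (λ j → Σℚ (λ i → f i j))
Σℚ-comm f = trans (Σℚ²≡sum² f) (trans (∑.∑-comm f) (sym (Σℚ²≡sum² (λ j i → f i j))))
  where
  Σℚ²≡sum² : ∀ {m n} (g : Fin m → Fin n → ℚ) →
    Σℚ (λ i → Σℚ (g i)) ≡ ∑.sum (λ i → ∑.sum (g i))
  Σℚ²≡sum² g = trans (Σℚ≡sum (λ i → Σℚ (g i))) (∑.sum-cong-≗ (λ i → Σℚ≡sum (g i)))

*-distribˡ-Σℚ : ∀ {n} c (f : Fin n → ℚ) → c * Σℚ f ≡ Σℚ (λ i → c * f i)
*-distribˡ-Σℚ c f = trans (cong (c *_) (Σℚ≡sum f)) (trans (∑.*-distribˡ-sum c f) (sym (Σℚ≡sum (λ i → c * f i))))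

*-distribʳ-Σℚ : ∀ {n} c (f : Fin n → ℚ) → Σℚ f * c ≡ Σℚ (λ i → f i * c)
*-distribʳ-Σℚ c f = trans (cong (_* c) (Σℚ≡sum f)) (trans (∑.*-distribʳ-sum c f) (sym (Σℚ≡sum (λ i → f i * c))))

Σℚ-punchIn : ∀ {n} (v : Fin (suc n)) (f : Fin (suc n) → ℚ) →
  Σℚ f ≡ f v + Σℚ (λ c → f (punchIn v c))
Σℚ-punchIn v f =
  trans (Σℚ≡sum f) (trans (∑.sum-remove {i = v} f) (cong (f v +_) (sym (Σℚ≡sum (λ c → f (punchIn v c))))))

Σℚ-zero : ∀ {n} {f : Fin n → ℚ} → (∀ i → f i ≡ 0ℚ) → Σℚ f ≡ 0ℚ
Σℚ-zero {n} f≗0 = trans (Σℚ-cong f≗0) (trans (Σℚ≡sum (λ (_ : Fin n) → 0ℚ)) (∑.sum-replicate-zero n))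

Σℚ-single : ∀ {n} (f : Fin n → ℚ) i → (∀ j → j ≢ i → f j ≡ 0ℚ) → Σℚ f ≡ f i
Σℚ-single {suc n} f i off = begin
  Σℚ f                               ≡⟨ Σℚ-punchIn i f ⟩
  f i + Σℚ (λ c → f (punchIn i c))   ≡⟨ cong (f i +_) (Σℚ-zero (λ c → off _ (punchInᵢ≢i i c))) ⟩
  f i + 0ℚ                           ≡⟨ +-identityʳ (f i) ⟩
  f i                                ∎
  where open ≡-Reasoning

Σℚ-distrib-neg : ∀ {n} (f : Fin n → ℚ) → Σℚ (λ i → - f i) ≡ - Σℚ f
Σℚ-distrib-neg {zero}  f = refl
Σℚ-distrib-neg {suc n} f =
  trans (cong (- f zero +_) (Σℚ-distrib-neg (λ i → f (suc i)))) (sym (neg-distrib-+ (f zero) _))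

Σℚ-distrib-sub : ∀ {n} (f g : Fin n → ℚ) → Σℚ (λ i → f i - g i) ≡ Σℚ f - Σℚ g
Σℚ-distrib-sub f g = trans (Σℚ-distrib-+ f (λ i → - g i)) (cong (Σℚ f +_) (Σℚ-distrib-neg g))

Σℚ-splitAt : ∀ m n (f : Fin (m ℕ.+ n) → ℚ) →
  Σℚ f ≡ Σℚ (λ a → f (a ↑ˡ n)) + Σℚ (λ c → f (m ↑ʳ c))
Σℚ-splitAt zero    n f = sym (+-identityˡ _)
Σℚ-splitAt (suc m) n f =
  trans (cong (f zero +_) (Σℚ-splitAt m n (λ i → f (suc i)))) (sym (+-assoc (f zero) _ _))

Σℚ-nonNeg : ∀ {n} (f : Fin n → ℚ) → (∀ i → 0ℚ ≤ f i) → 0ℚ ≤ Σℚ f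
Σℚ-nonNeg {zero}  f f≥0 = ≤-refl
Σℚ-nonNeg {suc n} f f≥0 =
  subst (_≤ Σℚ f) (+-identityˡ 0ℚ) (+-mono-≤ (f≥0 zero) (Σℚ-nonNeg _ (λ i → f≥0 (suc i))))

nonNeg-+-≡0ˡ : ∀ {p q} → 0ℚ ≤ p → 0ℚ ≤ q → p + q ≡ 0ℚ → p ≡ 0ℚ
nonNeg-+-≡0ˡ {p} p≥0 q≥0 p+q≡0 = ≤-antisym (subst₂ _≤_ (+-identityʳ p) p+q≡0 (+-monoʳ-≤ p q≥0)) p≥0

Σℚ-nonNeg-≡0 : ∀ {n} (f : Fin n → ℚ) → (∀ i → 0ℚ ≤ f i) → Σℚ f ≡ 0ℚ → ∀ i → f i ≡ 0ℚ
Σℚ-nonNeg-≡0 {suc n} f f≥0 Σ≡0 zero = nonNeg-+-≡0ˡ (f≥0 zero) (Σℚ-nonNeg _ (λ i → f≥0 (suc i))) Σ≡0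
Σℚ-nonNeg-≡0 {suc n} f f≥0 Σ≡0 (suc i) =
  Σℚ-nonNeg-≡0 (λ j → f (suc j)) (λ j → f≥0 (suc j))
    (nonNeg-+-≡0ˡ (Σℚ-nonNeg _ (λ j → f≥0 (suc j))) (f≥0 zero) (trans (+-comm _ (f zero)) Σ≡0)) i

Σℚ-separable : ∀ {m n} (α : Fin m → ℚ) (β : Fin n → ℚ) (g : Fin m → ℚ) (h : Fin n → ℚ) →
  Σℚ (λ i → α i * Σℚ (λ j → β j * (g i + h j))) ≡ Σℚ β * Σℚ (λ i → α i * g i) + Σℚ α * Σℚ (λ j → β j * h j)
Σℚ-separable α β g h = begin
  Σℚ (λ i → α i * Σℚ (λ j → β j * (g i + h j)))
    ≡⟨ Σℚ-cong (λ i → cong (α i *_) (trans (Σℚ-cong (λ j → *-distribˡ-+ (β j) (g i) (h j)))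
         (trans (Σℚ-distrib-+ (λ j → β j * g i) (λ j → β j * h j)) (cong (_+ Hβ) (sym (*-distribʳ-Σℚ (g i) β)))))) ⟩
  Σℚ (λ i → α i * (Σℚ β * g i + Hβ))
    ≡⟨ Σℚ-cong (λ i → solve 4 (λ a b c d → a :* (b :* c :+ d) := b :* (a :* c) :+ a :* d) refl (α i) (Σℚ β) (g i) Hβ) ⟩
  Σℚ (λ i → Σℚ β * (α i * g i) + α i * Hβ)
    ≡⟨ trans (Σℚ-distrib-+ (λ i → Σℚ β * (α i * g i)) (λ i → α i * Hβ))
             (sym (cong₂ _+_ (*-distribˡ-Σℚ (Σℚ β) (λ i → α i * g i)) (*-distribʳ-Σℚ Hβ α))) ⟩
  Σℚ β * Σℚ (λ i → α i * g i) + Σℚ α * Hβ ∎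
  where
  open ≡-Reasoning
  Hβ = Σℚ (λ j → β j * h j)

Σℚ²-factor : ∀ {m n} (α : Fin m → ℚ) (β : Fin n → ℚ) (f : Fin m → Fin n → ℚ) →
  Σℚ (λ i → Σℚ (λ j → (α i * β j) * f i j)) ≡ Σℚ (λ i → α i * Σℚ (λ j → β j * f i j))
Σℚ²-factor α β f =
  Σℚ-cong (λ i → trans (Σℚ-cong (λ j → *-assoc (α i) (β j) (f i j))) (sym (*-distribˡ-Σℚ (α i) (λ j → β j * f i j))))

Σℚ-weighted-sub : ∀ {n} (α f g : Fin n → ℚ) →
  Σℚ (λ i → α i * (f i - g i)) ≡ Σℚ (λ i → α i * f i) - Σℚ (λ i → α i * g i)
Σℚ-weighted-sub α f g = trans
  (Σℚ-cong (λ i → solve 3 (λ a p q → a :* (p :- q) := a :* p :- a :* q) refl (α i) (f i) (g i)))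
  (Σℚ-distrib-sub (λ i → α i * f i) (λ i → α i * g i))

Σℚ-weighted-comm : ∀ {m n} (α : Fin m → ℚ) (β : Fin n → ℚ) (f : Fin m → Fin n → ℚ) →
  Σℚ (λ i → α i * Σℚ (λ j → β j * f i j)) ≡ Σℚ (λ j → β j * Σℚ (λ i → α i * f i j))
Σℚ-weighted-comm α β f = begin
  Σℚ (λ i → α i * Σℚ (λ j → β j * f i j))     ≡⟨ sym (Σℚ²-factor α β f) ⟩
  Σℚ (λ i → Σℚ (λ j → (α i * β j) * f i j))   ≡⟨ Σℚ-comm (λ i j → (α i * β j) * f i j) ⟩
  Σℚ (λ j → Σℚ (λ i → (α i * β j) * f i j))   ≡⟨ Σℚ-cong (λ j → Σℚ-cong (λ i → cong (_* f i j) (*-comm (α i) (β j)))) ⟩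
  Σℚ (λ j → Σℚ (λ i → (β j * α i) * f i j))   ≡⟨ Σℚ²-factor β α (λ j i → f i j) ⟩
  Σℚ (λ j → β j * Σℚ (λ i → α i * f i j))     ∎
  where open ≡-Reasoning

-- Rational arithmetic

ℕ→ℚ≡mkℚ : ∀ k → ℕ→ℚ k ≡ mkℚ (ℤ.+ k) 0 (coprime-sym (1-coprimeTo k))
ℕ→ℚ≡mkℚ k = normalize-coprime (coprime-sym (1-coprimeTo k))

toℚᵘ-ℕ→ℚ : ∀ k → toℚᵘ (ℕ→ℚ k) ≃ᵘ mkℚᵘ (ℤ.+ k) 0
toℚᵘ-ℕ→ℚ k = toℚᵘ-cong (ℕ→ℚ≡mkℚ k)

ℕ→ℚ-+ : ∀ a b → ℕ→ℚ (a ℕ.+ b) ≡ ℕ→ℚ a + ℕ→ℚ b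
ℕ→ℚ-+ a b = toℚᵘ-injective (ℚᵘ.≃-trans (toℚᵘ-ℕ→ℚ (a ℕ.+ b)) (ℚᵘ.≃-trans (*≡* numerators)
  (ℚᵘ.≃-sym (ℚᵘ.≃-trans (toℚᵘ-homo-+ (ℕ→ℚ a) (ℕ→ℚ b)) (ℚᵘ.+-cong (toℚᵘ-ℕ→ℚ a) (toℚᵘ-ℕ→ℚ b))))))
  where
  numerators : ℤ.+ (a ℕ.+ b) ℤ.* ℤ.+ 1 ≡ (ℤ.+ a ℤ.* ℤ.+ 1 ℤ.+ ℤ.+ b ℤ.* ℤ.+ 1) ℤ.* ℤ.+ 1
  numerators = trans (ℤ.*-identityʳ _) (trans (ℤ.pos-+ a b)
    (sym (trans (ℤ.*-identityʳ _) (cong₂ ℤ._+_ (ℤ.*-identityʳ (ℤ.+ a)) (ℤ.*-identityʳ (ℤ.+ b))))))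

ℕ→ℚ-* : ∀ a b → ℕ→ℚ (a ℕ.* b) ≡ ℕ→ℚ a * ℕ→ℚ b
ℕ→ℚ-* a b = toℚᵘ-injective (ℚᵘ.≃-trans (toℚᵘ-ℕ→ℚ (a ℕ.* b)) (ℚᵘ.≃-trans (*≡* (cong (ℤ._* ℤ.+ 1) (ℤ.pos-* a b)))
  (ℚᵘ.≃-sym (ℚᵘ.≃-trans (toℚᵘ-homo-* (ℕ→ℚ a) (ℕ→ℚ b)) (ℚᵘ.*-cong (toℚᵘ-ℕ→ℚ a) (toℚᵘ-ℕ→ℚ b))))))

ℕ→ℚ-Σ : ∀ {n} (f : Fin n → ℕ) → ℕ→ℚ (Σℕ f) ≡ Σℚ (λ i → ℕ→ℚ (f i))
ℕ→ℚ-Σ {zero}  f = refl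
ℕ→ℚ-Σ {suc n} f = trans (ℕ→ℚ-+ (f zero) _) (cong (ℕ→ℚ (f zero) +_) (ℕ→ℚ-Σ (λ i → f (suc i))))

ℕ→ℚ-injective : ∀ {a b} → ℕ→ℚ a ≡ ℕ→ℚ b → a ≡ b
ℕ→ℚ-injective {a} {b} eq = ℤ.+-injective (cong ↥_ (trans (sym (ℕ→ℚ≡mkℚ a)) (trans eq (ℕ→ℚ≡mkℚ b))))

ℕ→ℚ-nonNeg : ∀ k → 0ℚ ≤ ℕ→ℚ k
ℕ→ℚ-nonNeg k = subst (0ℚ ≤_) (sym (ℕ→ℚ≡mkℚ k)) (nonNegative⁻¹ _)

ℕ→ℚ-pos : ∀ {k} → 1 ℕ.≤ k → 0ℚ < ℕ→ℚ k
ℕ→ℚ-pos {suc k} _ = subst (0ℚ <_) (sym (ℕ→ℚ≡mkℚ (suc k))) (positive⁻¹ _)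

*-nonNeg : ∀ {p q} → 0ℚ ≤ p → 0ℚ ≤ q → 0ℚ ≤ p * q
*-nonNeg {p} {q} p≥0 q≥0 = nonNegative⁻¹ (p * q) {{nonNeg*nonNeg⇒nonNeg p {{nonNegative p≥0}} q {{nonNegative q≥0}}}}

p≢0⇒p*p>0 : ∀ p → p ≢ 0ℚ → 0ℚ < p * p
p≢0⇒p*p>0 p p≢0 with <-cmp p 0ℚ
... | tri< p<0 _ _ = positive⁻¹ (p * p) {{neg*neg⇒pos p {{negative p<0}} p {{negative p<0}}}}
... | tri≈ _ p≡0 _ = ⊥-elim (p≢0 p≡0)
... | tri> _ _ p>0 = positive⁻¹ (p * p) {{pos*pos⇒pos p {{positive p>0}} p {{positive p>0}}}}

p*p-nonNeg : ∀ p → 0ℚ ≤ p * p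
p*p-nonNeg p with p ≟ℚ 0ℚ
... | yes refl = ≤-refl
... | no p≢0 = <⇒≤ (p≢0⇒p*p>0 p p≢0)

p*p≡0⇒p≡0 : ∀ p → p * p ≡ 0ℚ → p ≡ 0ℚ
p*p≡0⇒p≡0 p p*p≡0 with p ≟ℚ 0ℚ
... | yes p≡0 = p≡0
... | no p≢0 = ⊥-elim (<⇒≢ (p≢0⇒p*p>0 p p≢0) (sym p*p≡0))

p+p-nonNeg⇒p-nonNeg : ∀ p → 0ℚ ≤ p + p → 0ℚ ≤ p
p+p-nonNeg⇒p-nonNeg p 0≤p+p with ≤-total 0ℚ p
... | inj₁ 0≤p = 0≤p
... | inj₂ p≤0 = ≤-trans 0≤p+p (subst (p + p ≤_) (+-identityʳ p) (+-monoʳ-≤ p p≤0))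

p+p≡q+q⇒p≡q : ∀ {p q} → p + p ≡ q + q → p ≡ q
p+p≡q+q⇒p≡q {p} {q} eq = begin
  p             ≡⟨ solve 1 (λ x → x := con ½ :* (x :+ x)) refl p ⟩
  ½ * (p + p)   ≡⟨ cong (½ *_) eq ⟩
  ½ * (q + q)   ≡⟨ solve 1 (λ x → con ½ :* (x :+ x) := x) refl q ⟩
  q             ∎
  where open ≡-Reasoning

*-pos : ∀ {p q} → 0ℚ < p → 0ℚ < q → 0ℚ < p * q
*-pos {p} {q} p>0 q>0 = positive⁻¹ (p * q) {{pos*pos⇒pos p {{positive p>0}} q {{positive q>0}}}}

+-pos-nonNeg : ∀ {p q} → 0ℚ < p → 0ℚ ≤ q → 0ℚ < p + q
+-pos-nonNeg {p} {q} p>0 q≥0 = subst (_< p + q) (+-identityˡ 0ℚ) (+-mono-<-≤ p>0 q≥0)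

<-from-positive-gap : ∀ {a b P Q} → 0ℚ < P → (b - a) * P ≡ Q → 0ℚ < Q → a < b
<-from-positive-gap {a} {b} {P} P>0 gap Q>0 = subst₂ _<_ (+-identityʳ a)
  (solve 2 (λ x y → x :+ (y :- x) := y) refl a b)
  (+-monoʳ-< a (*-cancelʳ-<-nonNeg P {{nonNegative (<⇒≤ P>0)}} (subst₂ _<_ (sym (*-zeroˡ P)) (sym gap) Q>0)))

p-q≡0⇒p≡q : ∀ {p q} → p - q ≡ 0ℚ → p ≡ q
p-q≡0⇒p≡q {p} {q} = x∙y⁻¹≈ε⇒x≈y p q

-- Graph Laplacians and effective resistance

δ : ∀ {n} → Fin n → Fin n → ℚ
δ a b with a ≟ b
... | yes _ = 1ℚ
... | no  _ = 0ℚ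

δ-sym : ∀ {n} (a b : Fin n) → δ a b ≡ δ b a
δ-sym a b with a ≟ b | b ≟ a
... | yes _   | yes _   = refl
... | no  _   | no  _   = refl
... | yes a≡b | no  b≢a = ⊥-elim (b≢a (sym a≡b))
... | no  a≢b | yes b≡a = ⊥-elim (a≢b (sym b≡a))

δ-diag : ∀ {n} (a : Fin n) → δ a a ≡ 1ℚ
δ-diag a with a ≟ a
... | yes _   = refl
... | no  a≢a = ⊥-elim (a≢a refl)

δ-≢ : ∀ {n} {a b : Fin n} → a ≢ b → δ a b ≡ 0ℚ
δ-≢ {a = a} {b} a≢b with a ≟ b
... | yes a≡b = ⊥-elim (a≢b a≡b)
... | no  _   = refl

δ-injective : ∀ {m n} (f : Fin m → Fin n) → (∀ {a b} → f a ≡ f b → a ≡ b) → ∀ a b → δ (f a) (f b) ≡ δ a b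
δ-injective f f-inj a b with a ≟ b
... | yes refl = δ-diag (f a)
... | no  a≢b  = δ-≢ (λ fa≡fb → a≢b (f-inj fa≡fb))

Σℚ-δ : ∀ {n} (a : Fin n) (f : Fin n → ℚ) → Σℚ (λ k → δ a k * f k) ≡ f a
Σℚ-δ a f = trans (Σℚ-single (λ k → δ a k * f k) a (λ k k≢a → trans (cong (_* f k) (δ-≢ (λ a≡k → k≢a (sym a≡k)))) (*-zeroˡ (f k))))
                 (trans (cong (_* f a) (δ-diag a)) (*-identityˡ (f a)))

𝟙 : Bool → ℚ
𝟙 b = ℕ→ℚ (b2ℕ b)

𝟙-nonNeg : ∀ b → 0ℚ ≤ 𝟙 b
𝟙-nonNeg b = ℕ→ℚ-nonNeg (b2ℕ b)

𝟙*[p-p] : ∀ b {p q} → p ≡ q → 𝟙 b * (p - q) ≡ 0ℚ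
𝟙*[p-p] b {p} refl = trans (cong (𝟙 b *_) (+-inverseʳ p)) (*-zeroʳ (𝟙 b))

degℚ : ∀ {n} → Graph n → Fin n → ℚ
degℚ H i = ℕ→ℚ (degree H i)

degℚ≡Σ𝟙 : ∀ {n} (H : Graph n) i → degℚ H i ≡ Σℚ (λ j → 𝟙 (H i j))
degℚ≡Σ𝟙 H i = ℕ→ℚ-Σ (λ j → b2ℕ (H i j))

Lap : ∀ {n} → Graph n → (Fin n → ℚ) → Fin n → ℚ
Lap H x a = Σℚ (λ k → laplacian H a k * x k)

Lap-distrib-sub : ∀ {n} (H : Graph n) (x y : Fin n → ℚ) a → Lap H (λ k → x k - y k) a ≡ Lap H x a - Lap H y a
Lap-distrib-sub H x y a = Σℚ-weighted-sub (laplacian H a) x y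

Lap-distrib-+ : ∀ {n} (H : Graph n) (x y : Fin n → ℚ) a → Lap H (λ k → x k + y k) a ≡ Lap H x a + Lap H y a
Lap-distrib-+ H x y a = trans (Σℚ-cong (λ k → *-distribˡ-+ (laplacian H a k) (x k) (y k)))
  (Σℚ-distrib-+ (λ k → laplacian H a k * x k) (λ k → laplacian H a k * y k))

Lap-Σ : ∀ {m n} (H : Graph n) (t : Fin m → ℚ) (f : Fin m → Fin n → ℚ) a →
  Lap H (λ k → Σℚ (λ y → t y * f y k)) a ≡ Σℚ (λ y → t y * Lap H (f y) a)
Lap-Σ H t f a = Σℚ-weighted-comm (laplacian H a) t (λ k y → f y k)

module _ {n : ℕ} (H : Graph n) (simple : IsSimple H) where
  open IsSimple simple

  laplacian-term : ∀ (x : Fin n → ℚ) a k →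
    laplacian H a k * x k ≡ δ a k * (degℚ H a * x a) - 𝟙 (H a k) * x k
  laplacian-term x a k with a ≟ k
  ... | yes refl rewrite irrefl a =
    solve 2 (λ d p → d :* p := con 1ℚ :* (d :* p) :- con 0ℚ :* p) refl (degℚ H a) (x a)
  ... | no _ with H a k
  ...   | true  = solve 3 (λ d p q → (con 0ℚ :- con 1ℚ) :* q := con 0ℚ :* (d :* p) :- con 1ℚ :* q) refl (degℚ H a) (x a) (x k)
  ...   | false = solve 3 (λ d p q → con 0ℚ :* q := con 0ℚ :* (d :* p) :- con 0ℚ :* q) refl (degℚ H a) (x a) (x k)

  Lap-edgeForm : ∀ (x : Fin n → ℚ) a → Lap H x a ≡ Σℚ (λ k → 𝟙 (H a k) * (x a - x k))
  Lap-edgeForm x a = begin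
    Σℚ (λ k → laplacian H a k * x k)
      ≡⟨ Σℚ-cong (laplacian-term x a) ⟩
    Σℚ (λ k → δ a k * (degℚ H a * x a) - 𝟙 (H a k) * x k)
      ≡⟨ Σℚ-distrib-sub (λ k → δ a k * (degℚ H a * x a)) (λ k → 𝟙 (H a k) * x k) ⟩
    Σℚ (λ k → δ a k * (degℚ H a * x a)) - Σℚ (λ k → 𝟙 (H a k) * x k)
      ≡⟨ cong (_- Σℚ (λ k → 𝟙 (H a k) * x k)) (trans (Σℚ-δ a (λ _ → degℚ H a * x a))
           (trans (cong (_* x a) (degℚ≡Σ𝟙 H a)) (*-distribʳ-Σℚ (x a) (λ k → 𝟙 (H a k))))) ⟩
    Σℚ (λ k → 𝟙 (H a k) * x a) - Σℚ (λ k → 𝟙 (H a k) * x k)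
      ≡⟨ sym (Σℚ-distrib-sub (λ k → 𝟙 (H a k) * x a) (λ k → 𝟙 (H a k) * x k)) ⟩
    Σℚ (λ k → 𝟙 (H a k) * x a - 𝟙 (H a k) * x k)
      ≡⟨ Σℚ-cong (λ k → solve 3 (λ b p q → b :* p :- b :* q := b :* (p :- q)) refl (𝟙 (H a k)) (x a) (x k)) ⟩
    Σℚ (λ k → 𝟙 (H a k) * (x a - x k)) ∎
    where open ≡-Reasoning

  Lap-constant : ∀ (x : Fin n → ℚ) {c} → (∀ k → x k ≡ c) → ∀ a → Lap H x a ≡ 0ℚ
  Lap-constant x x≡ a = trans (Lap-edgeForm x a) (Σℚ-zero (λ k → 𝟙*[p-p] (H a k) (trans (x≡ a) (sym (x≡ k)))))

  laplacian-sym : ∀ a b → laplacian H a b ≡ laplacian H b a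
  laplacian-sym a b with a ≟ b | b ≟ a
  ... | yes refl | yes _    = refl
  ... | yes a≡b  | no  b≢a  = ⊥-elim (b≢a (sym a≡b))
  ... | no  a≢b  | yes b≡a  = ⊥-elim (a≢b (sym b≡a))
  ... | no  _    | no  _    rewrite symm a b = refl

  Σ-edges-swap : ∀ (f : Fin n → Fin n → ℚ) →
    Σℚ (λ a → Σℚ (λ k → 𝟙 (H a k) * f a k)) ≡ Σℚ (λ a → Σℚ (λ k → 𝟙 (H a k) * f k a))
  Σ-edges-swap f = trans (Σℚ-comm (λ a k → 𝟙 (H a k) * f a k))
    (Σℚ-cong (λ a → Σℚ-cong (λ k → cong (λ b → 𝟙 b * f k a) (symm k a))))

  Σ-Lap≡0 : ∀ (x : Fin n → ℚ) → Σℚ (Lap H x) ≡ 0ℚ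
  Σ-Lap≡0 x = p+p≡q+q⇒p≡q (trans (cong (E +_) E≡-E) (trans (+-inverseʳ E) (sym (+-identityʳ 0ℚ))))
    where
    E = Σℚ (Lap H x)
    E≡-E : E ≡ - E
    E≡-E = begin
      E
        ≡⟨ Σℚ-cong (Lap-edgeForm x) ⟩
      Σℚ (λ a → Σℚ (λ k → 𝟙 (H a k) * (x a - x k)))
        ≡⟨ Σ-edges-swap (λ a k → x a - x k) ⟩
      Σℚ (λ a → Σℚ (λ k → 𝟙 (H a k) * (x k - x a)))
        ≡⟨ Σℚ-cong (λ a → Σℚ-cong (λ k →
             solve 3 (λ b p q → b :* (q :- p) := :- (b :* (p :- q))) refl (𝟙 (H a k)) (x a) (x k))) ⟩
      Σℚ (λ a → Σℚ (λ k → - (𝟙 (H a k) * (x a - x k))))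
        ≡⟨ trans (Σℚ-cong (λ a → Σℚ-distrib-neg (λ k → 𝟙 (H a k) * (x a - x k))))
                 (Σℚ-distrib-neg (λ a → Σℚ (λ k → 𝟙 (H a k) * (x a - x k)))) ⟩
      - Σℚ (λ a → Σℚ (λ k → 𝟙 (H a k) * (x a - x k)))
        ≡⟨ cong -_ (sym (Σℚ-cong (Lap-edgeForm x))) ⟩
      - E ∎
      where open ≡-Reasoning

  Lap-quadraticForm : ∀ (x : Fin n → ℚ) →
    Σℚ (λ a → Lap H x a * x a) + Σℚ (λ a → Lap H x a * x a) ≡
    Σℚ (λ a → Σℚ (λ k → 𝟙 (H a k) * ((x a - x k) * (x a - x k))))
  Lap-quadraticForm x = begin
    Q + Q
      ≡⟨ cong₂ _+_ Q≡ (trans Q≡ (Σ-edges-swap (λ a k → (x a - x k) * x a))) ⟩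
    Σℚ (λ a → Σℚ (λ k → 𝟙 (H a k) * ((x a - x k) * x a))) + Σℚ (λ a → Σℚ (λ k → 𝟙 (H a k) * ((x k - x a) * x k)))
      ≡⟨ sym (trans (Σℚ-cong (λ a → Σℚ-distrib-+ (λ k → 𝟙 (H a k) * ((x a - x k) * x a)) (λ k → 𝟙 (H a k) * ((x k - x a) * x k))))
                    (Σℚ-distrib-+ (λ a → Σℚ (λ k → 𝟙 (H a k) * ((x a - x k) * x a)))
                                  (λ a → Σℚ (λ k → 𝟙 (H a k) * ((x k - x a) * x k))))) ⟩
    Σℚ (λ a → Σℚ (λ k → 𝟙 (H a k) * ((x a - x k) * x a) + 𝟙 (H a k) * ((x k - x a) * x k)))
      ≡⟨ Σℚ-cong (λ a → Σℚ-cong (λ k → solve 3 (λ b p q → b :* ((p :- q) :* p) :+ b :* ((q :- p) :* q)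
                                                          := b :* ((p :- q) :* (p :- q))) refl (𝟙 (H a k)) (x a) (x k))) ⟩
    Σℚ (λ a → Σℚ (λ k → 𝟙 (H a k) * ((x a - x k) * (x a - x k)))) ∎
    where
    open ≡-Reasoning
    Q = Σℚ (λ a → Lap H x a * x a)
    Q≡ : Q ≡ Σℚ (λ a → Σℚ (λ k → 𝟙 (H a k) * ((x a - x k) * x a)))
    Q≡ = Σℚ-cong (λ a → trans (cong (_* x a) (Lap-edgeForm x a)) (trans (*-distribʳ-Σℚ {n} (x a) _)
           (Σℚ-cong (λ k → *-assoc (𝟙 (H a k)) (x a - x k) (x a)))))

  edge-squares-nonNeg : ∀ (x : Fin n → ℚ) a k → 0ℚ ≤ 𝟙 (H a k) * ((x a - x k) * (x a - x k))
  edge-squares-nonNeg x a k = *-nonNeg (𝟙-nonNeg (H a k)) (p*p-nonNeg (x a - x k))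

  Lap-quadratic-nonNeg : ∀ (x : Fin n → ℚ) → 0ℚ ≤ Σℚ (λ a → Lap H x a * x a)
  Lap-quadratic-nonNeg x = p+p-nonNeg⇒p-nonNeg _ (subst (0ℚ ≤_) (sym (Lap-quadraticForm x))
    (Σℚ-nonNeg {n} _ (λ a → Σℚ-nonNeg {n} _ (edge-squares-nonNeg x a))))

  Lap≡0⇒edge-constant : ∀ (x : Fin n → ℚ) → (∀ a → Lap H x a ≡ 0ℚ) → ∀ {a k} → H a k ≡ true → x a ≡ x k
  Lap≡0⇒edge-constant x Lx≡0 {a} {k} Hak = p-q≡0⇒p≡q (p*p≡0⇒p≡0 _ (trans (sym (*-identityˡ _))
    (subst (λ b → 𝟙 b * ((x a - x k) * (x a - x k)) ≡ 0ℚ) Hak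
      (Σℚ-nonNeg-≡0 {n} _ (edge-squares-nonNeg x a)
        (Σℚ-nonNeg-≡0 {n} _ (λ a → Σℚ-nonNeg {n} _ (edge-squares-nonNeg x a)) squares≡0 a) k))))
    where
    squares≡0 : Σℚ (λ a → Σℚ (λ k → 𝟙 (H a k) * ((x a - x k) * (x a - x k)))) ≡ 0ℚ
    squares≡0 = trans (sym (Lap-quadraticForm x)) (trans (cong (λ q → q + q)
      (Σℚ-zero (λ a → trans (cong (_* x a) (Lx≡0 a)) (*-zeroˡ (x a))))) (+-identityˡ 0ℚ))

  Lap≡0⇒constant : Connected H → ∀ (x : Fin n → ℚ) → (∀ a → Lap H x a ≡ 0ℚ) → ∀ i j → x i ≡ x j
  Lap≡0⇒constant connected x Lx≡0 i j = along (connected i j)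
    where
    along : ∀ {i j} → Reach H i j → x i ≡ x j
    along here          = refl
    along (step Hij r)  = trans (Lap≡0⇒edge-constant x Lx≡0 Hij) (along r)

  module _ (connected : Connected H) (X : Mat n) (pinv : IsPseudoinverse (laplacian H) X) where
    open IsPseudoinverse pinv
    private
      L = laplacian H
      P = laplacian H ⊗ X

    LX-sym : ∀ a b → P a b ≡ P b a
    LX-sym a b = cong (λ M → M b a) p3

    Lap-[I-LX]≡0 : ∀ a b → Lap H (λ k → δ k a - P k a) b ≡ 0ℚ
    Lap-[I-LX]≡0 a b = begin
      Lap H (λ k → δ k a - P k a) b
        ≡⟨ Lap-distrib-sub H (λ k → δ k a) (λ k → P k a) b ⟩
      Σℚ (λ k → L b k * δ k a) - Σℚ (λ k → L b k * P k a)
        ≡⟨ cong₂ _-_ (trans (Σℚ-cong (λ k → trans (*-comm (L b k) (δ k a)) (cong (_* L b k) (δ-sym k a)))) (Σℚ-δ a (L b)))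
                     (Σℚ-cong (λ k → trans (*-comm (L b k) (P k a)) (cong₂ _*_ (LX-sym k a) (laplacian-sym b k)))) ⟩
      L b a - (P ⊗ L) a b
        ≡⟨ cong (λ z → L b a - z) (trans (cong (λ M → M a b) p1) (laplacian-sym a b)) ⟩
      L b a - L b a
        ≡⟨ +-inverseʳ (L b a) ⟩
      0ℚ ∎
      where open ≡-Reasoning

    potential : Fin n → Fin n → Fin n → ℚ
    potential i j k = X k i - X k j

    Lap-potential : ∀ i j a → Lap H (potential i j) a ≡ δ a i - δ a j
    Lap-potential i j a = begin
      Lap H (potential i j) a
        ≡⟨ Lap-distrib-sub H (λ k → X k i) (λ k → X k j) a ⟩
      P a i - P a j
        ≡⟨ cong₂ _-_ (LX-sym a i) (LX-sym a j) ⟩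
      P i a - P j a
        ≡⟨ solve 4 (λ p q d e → p :- q := (d :- e) :- ((d :- p) :- (e :- q))) refl (P i a) (P j a) (δ i a) (δ j a) ⟩
      (δ i a - δ j a) - ((δ i a - P i a) - (δ j a - P j a))
        ≡⟨ cong (λ z → (δ i a - δ j a) - z) (trans (cong (_- (δ j a - P j a)) I-LX-constant) (+-inverseʳ (δ j a - P j a))) ⟩
      (δ i a - δ j a) - 0ℚ
        ≡⟨ trans (cong₂ (λ p q → (p - q) - 0ℚ) (δ-sym i a) (δ-sym j a)) (+-identityʳ _) ⟩
      δ a i - δ a j ∎
      where
      open ≡-Reasoning
      I-LX-constant : δ i a - P i a ≡ δ j a - P j a
      I-LX-constant = Lap≡0⇒constant connected (λ k → δ k a - P k a) (Lap-[I-LX]≡0 a) i j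

    resistance-by-potential : ∀ i j (w : Fin n → ℚ) → (∀ a → Lap H w a ≡ δ a i - δ a j) →
      resistance X i j ≡ w i - w j
    resistance-by-potential i j w Lw = begin
      ((X i i + X j j) - X i j) - X j i
        ≡⟨ solve 6 (λ ii jj ij ji wi wj → ((ii :+ jj) :- ij) :- ji := ((ii :- ij :- wi) :- (ji :- jj :- wj)) :+ (wi :- wj))
                   refl (X i i) (X j j) (X i j) (X j i) (w i) (w j) ⟩
      ((potential i j i - w i) - (potential i j j - w j)) + (w i - w j)
        ≡⟨ cong (_+ (w i - w j)) (trans (cong (_- (potential i j j - w j)) gap-constant) (+-inverseʳ (potential i j j - w j))) ⟩
      0ℚ + (w i - w j)
        ≡⟨ +-identityˡ _ ⟩
      w i - w j ∎
      where
      open ≡-Reasoning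
      gap-constant : potential i j i - w i ≡ potential i j j - w j
      gap-constant = Lap≡0⇒constant connected (λ k → potential i j k - w k)
        (λ a → trans (Lap-distrib-sub H (potential i j) w a) (trans (cong₂ _-_ (Lap-potential i j a) (Lw a)) (+-inverseʳ (δ a i - δ a j)))) i j

    resistance≡potential : ∀ i j → resistance X i j ≡ potential i j i - potential i j j
    resistance≡potential i j = resistance-by-potential i j (potential i j) (Lap-potential i j)

    module _ (v : Fin n) (t : Fin n → ℚ) where
      private
        open ≡-Reasoning
        R = resistance X
        D = Σℚ t
        φ : Fin n → Fin n → ℚ
        φ y = potential y v
        p : Fin n → ℚ
        p k = Σℚ (λ y → t y * φ y k)
        Z = Σℚ (λ x → t x * (p x - p v))
        cross = Σℚ (λ x → t x * Σℚ (λ y → t y * ((R x v + R y v) - R x y)))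

        Lap-p : ∀ a → Lap H p a ≡ t a - D * δ a v
        Lap-p a = begin
          Lap H p a                                         ≡⟨ Lap-Σ H t φ a ⟩
          Σℚ (λ y → t y * Lap H (φ y) a)                    ≡⟨ Σℚ-cong (λ y → cong (t y *_) (Lap-potential y v a)) ⟩
          Σℚ (λ y → t y * (δ a y - δ a v))                  ≡⟨ Σℚ-weighted-sub t (δ a) (λ _ → δ a v) ⟩
          Σℚ (λ y → t y * δ a y) - Σℚ (λ y → t y * δ a v)   ≡⟨ cong₂ _-_ (trans (Σℚ-cong (λ y → *-comm (t y) (δ a y))) (Σℚ-δ a t))
                                                                         (sym (*-distribʳ-Σℚ (δ a v) t)) ⟩
          t a - D * δ a v                                   ∎

        Z≡pᵀLp : Z ≡ Σℚ (λ x → Lap H p x * p x)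
        Z≡pᵀLp = begin
          Z                                                             ≡⟨ Σℚ-weighted-sub t p (λ _ → p v) ⟩
          Σℚ (λ x → t x * p x) - Σℚ (λ x → t x * p v)                   ≡⟨ cong (λ z → Σℚ (λ x → t x * p x) - z) (sym Σ-at-v) ⟩
          Σℚ (λ x → t x * p x) - Σℚ (λ x → (D * δ x v) * p x)           ≡⟨ sym (Σℚ-distrib-sub (λ x → t x * p x) (λ x → (D * δ x v) * p x)) ⟩
          Σℚ (λ x → t x * p x - (D * δ x v) * p x)                      ≡⟨ Σℚ-cong (λ x → solve 3 (λ a b q → a :* q :- b :* q := (a :- b) :* q)
                                                                                                  refl (t x) (D * δ x v) (p x)) ⟩
          Σℚ (λ x → (t x - D * δ x v) * p x)                            ≡⟨ Σℚ-cong (λ x → cong (_* p x) (sym (Lap-p x))) ⟩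
          Σℚ (λ x → Lap H p x * p x)                                    ∎
          where
          Σ-at-v : Σℚ (λ x → (D * δ x v) * p x) ≡ Σℚ (λ x → t x * p v)
          Σ-at-v = begin
            Σℚ (λ x → (D * δ x v) * p x)   ≡⟨ Σℚ-cong (λ x → trans (cong (λ d → (D * d) * p x) (δ-sym x v))
                                                 (solve 3 (λ a d q → (a :* d) :* q := d :* (a :* q)) refl D (δ v x) (p x))) ⟩
            Σℚ (λ x → δ v x * (D * p x))   ≡⟨ Σℚ-δ v (λ x → D * p x) ⟩
            D * p v                         ≡⟨ *-distribʳ-Σℚ (p v) t ⟩
            Σℚ (λ x → t x * p v)           ∎

        Z≥0 : 0ℚ ≤ Z
        Z≥0 = subst (0ℚ ≤_) (sym Z≡pᵀLp) (Lap-quadratic-nonNeg p)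

        Σ-t-φ : ∀ x → Σℚ (λ y → t y * (φ y x - φ y v)) ≡ p x - p v
        Σ-t-φ x = Σℚ-weighted-sub t (λ y → φ y x) (λ y → φ y v)

        cross≡Z+Z : cross ≡ Z + Z
        cross≡Z+Z = begin
          cross
            ≡⟨ Σℚ-cong (λ x → cong (t x *_) (trans (Σℚ-cong (λ y → trans (cong (t y *_) (pair-identity x y)) (*-distribˡ-+ (t y) _ _)))
                                                   (Σℚ-distrib-+ (λ y → t y * (φ y x - φ y v)) (λ y → t y * (φ x y - φ x v))))) ⟩
          Σℚ (λ x → t x * (Σℚ (λ y → t y * (φ y x - φ y v)) + Σℚ (λ y → t y * (φ x y - φ x v))))
            ≡⟨ trans (Σℚ-cong (λ x → *-distribˡ-+ (t x) _ _)) (Σℚ-distrib-+ (λ x → t x * Σℚ (λ y → t y * (φ y x - φ y v)))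
                                                                         (λ x → t x * Σℚ (λ y → t y * (φ x y - φ x v)))) ⟩
          Σℚ (λ x → t x * Σℚ (λ y → t y * (φ y x - φ y v))) + Σℚ (λ x → t x * Σℚ (λ y → t y * (φ x y - φ x v)))
            ≡⟨ cong₂ _+_ (Σℚ-cong (λ x → cong (t x *_) (Σ-t-φ x)))
                         (trans (Σℚ-weighted-comm t t (λ x y → φ x y - φ x v)) (Σℚ-cong (λ y → cong (t y *_) (Σ-t-φ y)))) ⟩
          Z + Z ∎
          where
          pair-identity : ∀ x y → (R x v + R y v) - R x y ≡ (φ y x - φ y v) + (φ x y - φ x v)
          pair-identity x y = solve 9 (λ xx vv xv vx yy yv vy xy yx →
            ((((xx :+ vv) :- xv) :- vx) :+ (((yy :+ vv) :- yv) :- vy)) :- (((xx :+ yy) :- xy) :- yx)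
            := ((xy :- xv) :- (vy :- vv)) :+ ((yx :- yv) :- (vx :- vv))) refl
            (X x x) (X v v) (X x v) (X v x) (X y y) (X y v) (X v y) (X x y) (X y x)

        cross≡2DB-A : cross ≡ (D * Σℚ (λ x → t x * R x v) + D * Σℚ (λ x → t x * R x v)) - Σℚ (λ x → Σℚ (λ y → (t x * t y) * R x y))
        cross≡2DB-A = begin
          cross
            ≡⟨ Σℚ-cong (λ x → cong (t x *_) (Σℚ-weighted-sub t (λ y → R x v + R y v) (R x))) ⟩
          Σℚ (λ x → t x * (Σℚ (λ y → t y * (R x v + R y v)) - Σℚ (λ y → t y * R x y)))
            ≡⟨ Σℚ-weighted-sub t (λ x → Σℚ (λ y → t y * (R x v + R y v))) (λ x → Σℚ (λ y → t y * R x y)) ⟩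
          Σℚ (λ x → t x * Σℚ (λ y → t y * (R x v + R y v))) - Σℚ (λ x → t x * Σℚ (λ y → t y * R x y))
            ≡⟨ cong₂ _-_ (Σℚ-separable t t (λ x → R x v) (λ y → R y v)) (sym (Σℚ²-factor t t R)) ⟩
          (D * Σℚ (λ x → t x * R x v) + D * Σℚ (λ x → t x * R x v)) - Σℚ (λ x → Σℚ (λ y → (t x * t y) * R x y)) ∎

      -- The left-hand side is 2 pᵀ L p for the potential p = Σ_y t_y (potential y v).
      weighted-resistance-bound :
        0ℚ ≤ (Σℚ t * Σℚ (λ x → t x * resistance X x v) + Σℚ t * Σℚ (λ x → t x * resistance X x v))
             - Σℚ (λ x → Σℚ (λ y → (t x * t y) * resistance X x y))
      weighted-resistance-bound =
        subst (0ℚ ≤_) (trans (sym cross≡Z+Z) cross≡2DB-A) (subst (_≤ Z + Z) (+-identityˡ 0ℚ) (+-mono-≤ Z≥0 Z≥0))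

resistance-sym : ∀ {n} (M : Mat n) i j → resistance M i j ≡ resistance M j i
resistance-sym M i j =
  solve 4 (λ a b c d → ((a :+ b) :- c) :- d := ((b :+ a) :- d) :- c) refl (M i i) (M j j) (M i j) (M j i)

-- Edge counts and Kemeny's constant

before : ∀ {n} → Fin n → Fin n → Bool
before i j = toℕ i ℕ.<ᵇ toℕ j

before-exactly-one : ∀ {n} {i j : Fin n} → i ≢ j → 𝟙 (before i j) + 𝟙 (before j i) ≡ 1ℚ
before-exactly-one {i = i} {j} i≢j with before i j in i<ᵇj | before j i in j<ᵇi
... | true  | true  = ⊥-elim (ℕ.<-asym (ℕ.<ᵇ⇒< (toℕ i) (toℕ j) (subst T (sym i<ᵇj) _)) (ℕ.<ᵇ⇒< (toℕ j) (toℕ i) (subst T (sym j<ᵇi) _)))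
... | true  | false = refl
... | false | true  = refl
... | false | false = ⊥-elim (i≢j (toℕ-injective (ℕ.≤-antisym (ℕ.≮⇒≥ (not-< j<ᵇi)) (ℕ.≮⇒≥ (not-< i<ᵇj)))))
  where
  not-< : ∀ {a b} → (a ℕ.<ᵇ b) ≡ false → ¬ (a ℕ.< b)
  not-< a<ᵇb≡false a<b = subst T a<ᵇb≡false (ℕ.<⇒<ᵇ a<b)

ℕ→ℚ-edgeCount : ∀ {n} (H : Graph n) → ℕ→ℚ (edgeCount H) ≡ Σℚ (λ i → Σℚ (λ j → 𝟙 (H i j ∧ before i j)))
ℕ→ℚ-edgeCount H = trans (ℕ→ℚ-Σ (λ i → Σℕ (λ j → b2ℕ (H i j ∧ before i j))))
                        (Σℚ-cong (λ i → ℕ→ℚ-Σ (λ j → b2ℕ (H i j ∧ before i j))))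

module _ {n : ℕ} (H : Graph n) (simple : IsSimple H) where
  open IsSimple simple

  𝟙-edge-split : ∀ i j → 𝟙 (H i j) ≡ 𝟙 (H i j ∧ before i j) + 𝟙 (H j i ∧ before j i)
  𝟙-edge-split i j with H i j in Hij
  ... | false rewrite trans (symm j i) Hij = refl
  ... | true  rewrite trans (symm j i) Hij = sym (before-exactly-one i≢j)
    where
    i≢j : i ≢ j
    i≢j refl with trans (sym Hij) (irrefl i)
    ... | ()

  handshake : ℕ→ℚ (edgeCount H) + ℕ→ℚ (edgeCount H) ≡ Σℚ (degℚ H)
  handshake = begin
    ℕ→ℚ (edgeCount H) + ℕ→ℚ (edgeCount H)
      ≡⟨ cong₂ _+_ (ℕ→ℚ-edgeCount H) (trans (ℕ→ℚ-edgeCount H) (Σℚ-comm (λ i j → 𝟙 (H i j ∧ before i j)))) ⟩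
    Σℚ (λ i → Σℚ (λ j → 𝟙 (H i j ∧ before i j))) + Σℚ (λ i → Σℚ (λ j → 𝟙 (H j i ∧ before j i)))
      ≡⟨ sym (trans (Σℚ-cong (λ i → Σℚ-distrib-+ (λ j → 𝟙 (H i j ∧ before i j)) (λ j → 𝟙 (H j i ∧ before j i))))
                    (Σℚ-distrib-+ (λ i → Σℚ (λ j → 𝟙 (H i j ∧ before i j))) (λ i → Σℚ (λ j → 𝟙 (H j i ∧ before j i))))) ⟩
    Σℚ (λ i → Σℚ (λ j → 𝟙 (H i j ∧ before i j) + 𝟙 (H j i ∧ before j i)))
      ≡⟨ sym (Σℚ-cong (λ i → trans (degℚ≡Σ𝟙 H i) (Σℚ-cong (𝟙-edge-split i)))) ⟩
    Σℚ (degℚ H) ∎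
    where open ≡-Reasoning

degreeResistanceSum : ∀ {n} → Graph n → Mat n → ℚ
degreeResistanceSum H X = Σℚ (λ i → Σℚ (λ j → (degℚ H i * degℚ H j) * resistance X i j))

inv-*-ℕ→ℚ : ∀ {k} → 1 ℕ.≤ k → inv k * ℕ→ℚ k ≡ 1ℚ
inv-*-ℕ→ℚ {suc k} _ = toℚᵘ-injective (ℚᵘ.≃-trans (toℚᵘ-homo-* (inv (suc k)) (ℕ→ℚ (suc k)))
  (ℚᵘ.≃-trans (ℚᵘ.*-cong (toℚᵘ-cong (normalize-coprime (1-coprimeTo (suc k)))) (toℚᵘ-ℕ→ℚ (suc k)))
    (*≡* (trans (ℤ.*-identityʳ _) (trans (ℤ.*-comm (ℤ.+ 1) (ℤ.+ suc k)) (sym (ℤ.*-identityˡ _)))))))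

kemeny-*-4m : ∀ {n} (H : Graph n) (X : Mat n) → 1 ℕ.≤ edgeCount H →
  kemeny H X * (ℕ→ℚ 4 * ℕ→ℚ (edgeCount H)) ≡ degreeResistanceSum H X
kemeny-*-4m H X m≥1 = begin
  inv 4m * S * (ℕ→ℚ 4 * ℕ→ℚ (edgeCount H))   ≡⟨ cong (inv 4m * S *_) (sym (ℕ→ℚ-* 4 (edgeCount H))) ⟩
  inv 4m * S * ℕ→ℚ 4m                        ≡⟨ solve 3 (λ i t m → i :* t :* m := t :* (i :* m)) refl (inv 4m) S (ℕ→ℚ 4m) ⟩
  S * (inv 4m * ℕ→ℚ 4m)                      ≡⟨ cong (S *_) (inv-*-ℕ→ℚ (ℕ.≤-trans m≥1 (ℕ.m≤n*m (edgeCount H) 4))) ⟩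
  S * 1ℚ                                      ≡⟨ *-identityʳ S ⟩
  S                                           ∎
  where
  open ≡-Reasoning
  4m = 4 ℕ.* edgeCount H
  S = degreeResistanceSum H X

kemeny-gap-identity : ∀ (K K̂ K₂ K̂₂ S₁ Ŝ₁ μ₁ μ̂₁ μ₂ μ̂₂ m₁ m₂ m̂₂ l : ℚ) →
  Ŝ₁ ≡ S₁ → μ̂₁ ≡ μ₁ → m̂₂ ≡ m₂ + l →
  K * (ℕ→ℚ 4 * (m₁ + m₂)) ≡
    (S₁ + K₂ * (ℕ→ℚ 4 * m₂)) + (((m₂ + m₂) * μ₁ + (m₁ + m₁) * μ₂) + ((m₂ + m₂) * μ₁ + (m₁ + m₁) * μ₂)) →
  K̂ * (ℕ→ℚ 4 * (m₁ + m̂₂)) ≡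
    (Ŝ₁ + K̂₂ * (ℕ→ℚ 4 * m̂₂)) + (((m̂₂ + m̂₂) * μ̂₁ + (m₁ + m₁) * μ̂₂) + ((m̂₂ + m̂₂) * μ̂₁ + (m₁ + m₁) * μ̂₂)) →
  (K̂ - K) * ((ℕ→ℚ 4 * (m₁ + m₂)) * (ℕ→ℚ 4 * (m₁ + m̂₂))) ≡
    ℕ→ℚ 16 * (((μ̂₂ - μ₂) * (m₁ * m₁) + (((μ̂₂ - μ₂) + (K̂₂ - K₂)) * m₂ + (K̂₂ - μ₂) * l) * m₁)
              + (K̂₂ - K₂) * (m₂ * m₂ + l * m₂))
    + (ℕ→ℚ 4 * l) * (((m₁ + m₁) * μ₁ + (m₁ + m₁) * μ₁) - S₁)
kemeny-gap-identity K K̂ K₂ K̂₂ S₁ _ μ₁ _ μ₂ μ̂₂ m₁ m₂ _ l refl refl refl K≡ K̂≡ = begin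
  (K̂ - K) * (4M * 4M̂)
    ≡⟨ solve 4 (λ k k̂ a b → (k̂ :- k) :* (a :* b) := (k̂ :* b) :* a :- (k :* a) :* b) refl K K̂ 4M 4M̂ ⟩
  (K̂ * 4M̂) * 4M - (K * 4M) * 4M̂
    ≡⟨ cong₂ (λ u v → u * 4M - v * 4M̂) K̂≡ K≡ ⟩
  _ ≡⟨ solve 9 (λ S₁ μ₁ μ₂ μ̂₂ K₂ K̂₂ m₁ m₂ l →
         ((S₁ :+ K̂₂ :* (con (ℕ→ℚ 4) :* (m₂ :+ l))) :+ ((((m₂ :+ l) :+ (m₂ :+ l)) :* μ₁ :+ (m₁ :+ m₁) :* μ̂₂)
                                                    :+ (((m₂ :+ l) :+ (m₂ :+ l)) :* μ₁ :+ (m₁ :+ m₁) :* μ̂₂)))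
           :* (con (ℕ→ℚ 4) :* (m₁ :+ m₂))
         :- ((S₁ :+ K₂ :* (con (ℕ→ℚ 4) :* m₂)) :+ (((m₂ :+ m₂) :* μ₁ :+ (m₁ :+ m₁) :* μ₂)
                                                 :+ ((m₂ :+ m₂) :* μ₁ :+ (m₁ :+ m₁) :* μ₂)))
           :* (con (ℕ→ℚ 4) :* (m₁ :+ (m₂ :+ l)))
         := con (ℕ→ℚ 16) :* (((μ̂₂ :- μ₂) :* (m₁ :* m₁) :+ (((μ̂₂ :- μ₂) :+ (K̂₂ :- K₂)) :* m₂ :+ (K̂₂ :- μ₂) :* l) :* m₁)
                            :+ (K̂₂ :- K₂) :* (m₂ :* m₂ :+ l :* m₂))
            :+ (con (ℕ→ℚ 4) :* l) :* (((m₁ :+ m₁) :* μ₁ :+ (m₁ :+ m₁) :* μ₁) :- S₁))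
       refl S₁ μ₁ μ₂ μ̂₂ K₂ K̂₂ m₁ m₂ l ⟩
  _ ∎
  where
  open ≡-Reasoning
  4M = ℕ→ℚ 4 * (m₁ + m₂)
  4M̂ = ℕ→ℚ 4 * (m₁ + (m₂ + l))

-- Graph constructions

addEdges-simple : ∀ {n} {H S : Graph n} → IsSimple H → IsSimple S → IsSimple (addEdges H S)
addEdges-simple sH sS = record
  { symm   = λ i j → cong₂ _∨_ (IsSimple.symm sH i j) (IsSimple.symm sS i j)
  ; irrefl = λ i → cong₂ _∨_ (IsSimple.irrefl sH i) (IsSimple.irrefl sS i) }

reach-map : ∀ {m n} {A : Graph m} {B : Graph n} (f : Fin m → Fin n) →
  (∀ {a b} → A a b ≡ true → B (f a) (f b) ≡ true) → ∀ {a b} → Reach A a b → Reach B (f a) (f b)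
reach-map f f-edge here         = here
reach-map f f-edge (step e r)   = step (f-edge e) (reach-map f f-edge r)

reach-trans : ∀ {n} {A : Graph n} {a b c} → Reach A a b → Reach A b c → Reach A a c
reach-trans here       r′ = r′
reach-trans (step e r) r′ = step e (reach-trans r r′)

addEdges-connected : ∀ {n} {H : Graph n} (S : Graph n) → Connected H → Connected (addEdges H S)
addEdges-connected S connected i j = reach-map (λ x → x) (λ {a} {b} e → cong (_∨ S a b) e) (connected i j)

module _ {m p : ℕ} (K : Graph m) (f : Fin p → Maybe (Fin m)) where

  liftAdj-just : ∀ {x y a b} → f x ≡ just a → f y ≡ just b → liftAdj K f x y ≡ K a b
  liftAdj-just {x} {y} fx fy with f x | f y
  liftAdj-just refl refl | just _ | just _ = refl

  liftAdj-nothingˡ : ∀ {x y} → f x ≡ nothing → liftAdj K f x y ≡ false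
  liftAdj-nothingˡ {x} {y} fx with f x | f y
  liftAdj-nothingˡ refl | nothing | _ = refl

  liftAdj-nothingʳ : ∀ {x y} → f y ≡ nothing → liftAdj K f x y ≡ false
  liftAdj-nothingʳ {x} {y} fy with f x | f y
  liftAdj-nothingʳ refl | just _  | nothing = refl
  liftAdj-nothingʳ refl | nothing | nothing = refl

  liftAdj-true : ∀ {x y} → liftAdj K f x y ≡ true → (Σ (Fin m) λ a → f x ≡ just a) × (Σ (Fin m) λ b → f y ≡ just b)
  liftAdj-true {x} {y} e with f x | f y
  ... | just a  | just b  = (a , refl) , (b , refl)
  liftAdj-true () | just _  | nothing
  liftAdj-true () | nothing | _

  liftAdj-simple : IsSimple K → IsSimple (liftAdj K f)
  liftAdj-simple sK = record { symm = symm ; irrefl = irrefl }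
    where
    symm : ∀ x y → liftAdj K f x y ≡ liftAdj K f y x
    symm x y with f x | f y
    ... | just a  | just b  = IsSimple.symm sK a b
    ... | just _  | nothing = refl
    ... | nothing | just _  = refl
    ... | nothing | nothing = refl
    irrefl : ∀ x → liftAdj K f x x ≡ false
    irrefl x with f x
    ... | just a  = IsSimple.irrefl sK a
    ... | nothing = refl

Lap-addEdges-flat : ∀ {n} {H S : Graph n} (w : Fin n → ℚ) → IsSimple H → IsSimple S →
  (∀ {x y} → S x y ≡ true → w x ≡ w y) → ∀ x → Lap (addEdges H S) w x ≡ Lap H w x
Lap-addEdges-flat {H = H} {S} w sH sS S-flat x = begin
  Lap (addEdges H S) w x                         ≡⟨ Lap-edgeForm (addEdges H S) (addEdges-simple sH sS) w x ⟩
  Σℚ (λ y → 𝟙 (H x y ∨ S x y) * (w x - w y))     ≡⟨ Σℚ-cong (λ y → flat-term (H x y) (S x y) S-flat) ⟩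
  Σℚ (λ y → 𝟙 (H x y) * (w x - w y))             ≡⟨ sym (Lap-edgeForm H sH w x) ⟩
  Lap H w x                                       ∎
  where
  open ≡-Reasoning
  flat-term : ∀ {y} b s → (s ≡ true → w x ≡ w y) → 𝟙 (b ∨ s) * (w x - w y) ≡ 𝟙 b * (w x - w y)
  flat-term b true  flat = trans (𝟙*[p-p] (b ∨ true) (flat refl)) (sym (𝟙*[p-p] b (flat refl)))
  flat-term b false _    = cong (λ c → 𝟙 c * _) (∨-identityʳ b)

edgeCount-addEdges : ∀ {n} {H S : Graph n} → (∀ {i j} → S i j ≡ true → H i j ≡ false) →
  edgeCount (addEdges H S) ≡ edgeCount H ℕ.+ edgeCount S
edgeCount-addEdges {H = H} {S} disjoint = ℕ→ℚ-injective (begin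
  ℕ→ℚ (edgeCount (addEdges H S))
    ≡⟨ ℕ→ℚ-edgeCount (addEdges H S) ⟩
  Σℚ (λ i → Σℚ (λ j → 𝟙 ((H i j ∨ S i j) ∧ before i j)))
    ≡⟨ Σℚ-cong (λ i → trans (Σℚ-cong (λ j → disjoint-term (H i j) (S i j) (before i j) disjoint))
                            (Σℚ-distrib-+ (λ j → 𝟙 (H i j ∧ before i j)) (λ j → 𝟙 (S i j ∧ before i j)))) ⟩
  Σℚ (λ i → Σℚ (λ j → 𝟙 (H i j ∧ before i j)) + Σℚ (λ j → 𝟙 (S i j ∧ before i j)))
    ≡⟨ Σℚ-distrib-+ (λ i → Σℚ (λ j → 𝟙 (H i j ∧ before i j))) (λ i → Σℚ (λ j → 𝟙 (S i j ∧ before i j))) ⟩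
  Σℚ (λ i → Σℚ (λ j → 𝟙 (H i j ∧ before i j))) + Σℚ (λ i → Σℚ (λ j → 𝟙 (S i j ∧ before i j)))
    ≡⟨ sym (trans (ℕ→ℚ-+ (edgeCount H) (edgeCount S)) (cong₂ _+_ (ℕ→ℚ-edgeCount H) (ℕ→ℚ-edgeCount S))) ⟩
  ℕ→ℚ (edgeCount H ℕ.+ edgeCount S) ∎)
  where
  open ≡-Reasoning
  disjoint-term : ∀ h s t → (s ≡ true → h ≡ false) → 𝟙 ((h ∨ s) ∧ t) ≡ 𝟙 (h ∧ t) + 𝟙 (s ∧ t)
  disjoint-term true  true  t h≡false with h≡false refl
  ... | ()
  disjoint-term true  false true  _ = refl
  disjoint-term true  false false _ = refl
  disjoint-term false true  true  _ = refl
  disjoint-term false true  false _ = refl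
  disjoint-term false false t     _ = refl

-- One-sums

module OneSum {n₁ k : ℕ} (v₁ : Fin n₁) (v₂ : Fin (suc k)) where
  N : ℕ
  N = n₁ ℕ.+ k

  ι₁ : Fin n₁ → Fin N
  ι₁ a = a ↑ˡ k

  ρ : Fin k → Fin N
  ρ c = n₁ ↑ʳ c

  rest₂ : Fin k → Fin (suc k)
  rest₂ = punchIn v₂

  ι₂ : Fin (suc k) → Fin N
  ι₂ b with v₂ ≟ b
  ... | yes _    = ι₁ v₁
  ... | no  v₂≢b = ρ (punchOut v₂≢b)

  ι₂-v₂ : ι₂ v₂ ≡ ι₁ v₁
  ι₂-v₂ with v₂ ≟ v₂
  ... | yes _    = refl
  ... | no  v₂≢v₂ = ⊥-elim (v₂≢v₂ refl)

  ι₂-rest₂ : ∀ c → ι₂ (rest₂ c) ≡ ρ c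
  ι₂-rest₂ c with v₂ ≟ rest₂ c
  ... | yes v₂≡ = ⊥-elim (punchInᵢ≢i v₂ c (sym v₂≡))
  ... | no  _   = cong ρ (trans (punchOut-cong v₂ refl) (punchOut-punchIn v₂))

  ι₁≢ρ : ∀ a c → ι₁ a ≢ ρ c
  ι₁≢ρ a c eq with trans (sym (splitAt-↑ˡ n₁ a k)) (trans (cong (splitAt n₁) eq) (splitAt-↑ʳ n₁ k c))
  ... | ()

  ι₁-injective : ∀ {a b} → ι₁ a ≡ ι₁ b → a ≡ b
  ι₁-injective = ↑ˡ-injective k _ _

  ρ-injective : ∀ {c d} → ρ c ≡ ρ d → c ≡ d
  ρ-injective = ↑ʳ-injective n₁ _ _

  split-view : ∀ x → (Σ (Fin n₁) λ a → x ≡ ι₁ a) ⊎ (Σ (Fin k) λ c → x ≡ ρ c)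
  split-view x with splitAt n₁ x in eq
  ... | inj₁ a = inj₁ (a , trans (sym (join-splitAt n₁ k x)) (cong (join n₁ k) eq))
  ... | inj₂ c = inj₂ (c , trans (sym (join-splitAt n₁ k x)) (cong (join n₁ k) eq))

  cut-view : ∀ b → (b ≡ v₂) ⊎ (Σ (Fin k) λ c → b ≡ rest₂ c)
  cut-view b with v₂ ≟ b
  ... | yes v₂≡b = inj₁ (sym v₂≡b)
  ... | no  v₂≢b = inj₂ (punchOut v₂≢b , sym (punchIn-punchOut v₂≢b))

  ι₂-injective : ∀ {p q} → ι₂ p ≡ ι₂ q → p ≡ q
  ι₂-injective {p} {q} eq with cut-view p | cut-view q
  ... | inj₁ refl       | inj₁ refl       = refl
  ... | inj₁ refl       | inj₂ (c , refl) = ⊥-elim (ι₁≢ρ v₁ c (trans (sym ι₂-v₂) (trans eq (ι₂-rest₂ c))))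
  ... | inj₂ (c , refl) | inj₁ refl       = ⊥-elim (ι₁≢ρ v₁ c (trans (sym ι₂-v₂) (trans (sym eq) (ι₂-rest₂ c))))
  ... | inj₂ (c , refl) | inj₂ (d , refl) = cong rest₂ (ρ-injective (trans (sym (ι₂-rest₂ c)) (trans eq (ι₂-rest₂ d))))

  ι₁≢ι₂ : ∀ {a} b → a ≢ v₁ → ι₁ a ≢ ι₂ b
  ι₁≢ι₂ {a} b a≢v₁ eq with cut-view b
  ... | inj₁ refl       = a≢v₁ (ι₁-injective (trans eq ι₂-v₂))
  ... | inj₂ (c , refl) = ι₁≢ρ a c (trans eq (ι₂-rest₂ c))

  δ-ι₂ : ∀ p q → δ (ι₂ p) (ι₂ q) ≡ δ p q
  δ-ι₂ = δ-injective ι₂ ι₂-injective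

  δ-ρ-ι₁ : ∀ c a → δ (ρ c) (ι₁ a) ≡ 0ℚ
  δ-ρ-ι₁ c a = δ-≢ (λ eq → ι₁≢ρ a c (sym eq))

  Σ-N : (f : Fin N → ℚ) → Σℚ f ≡ Σℚ (λ a → f (ι₁ a)) + Σℚ (λ c → f (ρ c))
  Σ-N = Σℚ-splitAt n₁ k

  Σ-cut : (g : Fin (suc k) → ℚ) → Σℚ g ≡ g v₂ + Σℚ (λ c → g (rest₂ c))
  Σ-cut = Σℚ-punchIn v₂

  from₁-ι₁ : ∀ a → from₁ {n₁} {k} (ι₁ a) ≡ just a
  from₁-ι₁ a rewrite splitAt-↑ˡ n₁ a k = refl

  from₁-ρ : ∀ c → from₁ {n₁} {k} (ρ c) ≡ nothing
  from₁-ρ c rewrite splitAt-↑ʳ n₁ k c = refl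

  from₁-ι₂-rest₂ : ∀ c → from₁ {n₁} {k} (ι₂ (rest₂ c)) ≡ nothing
  from₁-ι₂-rest₂ c = trans (cong from₁ (ι₂-rest₂ c)) (from₁-ρ c)

  from₂-ρ : ∀ c → from₂ v₁ v₂ (ρ c) ≡ just (rest₂ c)
  from₂-ρ c rewrite splitAt-↑ʳ n₁ k c = refl

  from₂-ι₁-v₁ : from₂ v₁ v₂ (ι₁ v₁) ≡ just v₂
  from₂-ι₁-v₁ rewrite splitAt-↑ˡ n₁ v₁ k with v₁ ≟ v₁
  ... | yes _     = refl
  ... | no  v₁≢v₁ = ⊥-elim (v₁≢v₁ refl)

  from₂-ι₁ : ∀ {a} → a ≢ v₁ → from₂ v₁ v₂ (ι₁ a) ≡ nothing
  from₂-ι₁ {a} a≢v₁ rewrite splitAt-↑ˡ n₁ a k with a ≟ v₁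
  ... | yes a≡v₁ = ⊥-elim (a≢v₁ a≡v₁)
  ... | no  _    = refl

  from₂-ι₂ : ∀ b → from₂ v₁ v₂ (ι₂ b) ≡ just b
  from₂-ι₂ b with cut-view b
  ... | inj₁ refl       = trans (cong (from₂ v₁ v₂) ι₂-v₂) from₂-ι₁-v₁
  ... | inj₂ (c , refl) = trans (cong (from₂ v₁ v₂) (ι₂-rest₂ c)) (from₂-ρ c)

  from₂-just : ∀ {x b} → from₂ v₁ v₂ x ≡ just b → x ≡ ι₂ b
  from₂-just {x} eq with split-view x
  ... | inj₂ (c , refl) with trans (sym eq) (from₂-ρ c)
  ...   | refl = sym (ι₂-rest₂ c)
  from₂-just {x} eq | inj₁ (a , refl) with a ≟ v₁
  ... | yes refl with trans (sym eq) from₂-ι₁-v₁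
  ...   | refl = sym ι₂-v₂
  from₂-just {x} eq | inj₁ (a , refl) | no a≢v₁ with trans (sym eq) (from₂-ι₁ a≢v₁)
  ... | ()

  record IsOneSum (H₁ : Graph n₁) (H₂ : Graph (suc k)) (H : Graph N) : Set where
    field
      left   : ∀ a a′ → H (ι₁ a) (ι₁ a′) ≡ H₁ a a′
      right  : ∀ b b′ → H (ι₂ b) (ι₂ b′) ≡ H₂ b b′
      across : ∀ {a} c → a ≢ v₁ → H (ι₁ a) (ρ c) ≡ false

  module _ {K : Graph (suc k)} (sK : IsSimple K) where
    private
      LK = liftAdj K (from₂ v₁ v₂)

    lift₂-left : ∀ a a′ → LK (ι₁ a) (ι₁ a′) ≡ false
    lift₂-left a a′ with a ≟ v₁ | a′ ≟ v₁
    ... | no a≢v₁  | _         = liftAdj-nothingˡ K (from₂ v₁ v₂) (from₂-ι₁ a≢v₁)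
    ... | yes _    | no a′≢v₁  = liftAdj-nothingʳ K (from₂ v₁ v₂) (from₂-ι₁ a′≢v₁)
    ... | yes refl | yes refl  = trans (liftAdj-just K (from₂ v₁ v₂) from₂-ι₁-v₁ from₂-ι₁-v₁) (IsSimple.irrefl sK v₂)

    lift₂-right : ∀ b b′ → LK (ι₂ b) (ι₂ b′) ≡ K b b′
    lift₂-right b b′ = liftAdj-just K (from₂ v₁ v₂) (from₂-ι₂ b) (from₂-ι₂ b′)

    lift₂-across : ∀ {a} c → a ≢ v₁ → LK (ι₁ a) (ρ c) ≡ false
    lift₂-across c a≢v₁ = liftAdj-nothingˡ K (from₂ v₁ v₂) (from₂-ι₁ a≢v₁)

  module _ {K : Graph n₁} (sK : IsSimple K) where
    private
      LK = liftAdj K (from₁ {n₁} {k})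

    lift₁-left : ∀ a a′ → LK (ι₁ a) (ι₁ a′) ≡ K a a′
    lift₁-left a a′ = liftAdj-just K from₁ (from₁-ι₁ a) (from₁-ι₁ a′)

    lift₁-right : ∀ b b′ → LK (ι₂ b) (ι₂ b′) ≡ false
    lift₁-right b b′ with cut-view b | cut-view b′
    ... | inj₂ (c , refl) | _               = liftAdj-nothingˡ K from₁ (from₁-ι₂-rest₂ c)
    ... | inj₁ refl       | inj₂ (c , refl) = liftAdj-nothingʳ K from₁ (from₁-ι₂-rest₂ c)
    ... | inj₁ refl       | inj₁ refl       =
      trans (cong₂ LK ι₂-v₂ ι₂-v₂) (trans (lift₁-left v₁ v₁) (IsSimple.irrefl sK v₁))

    lift₁-across : ∀ a c → LK (ι₁ a) (ρ c) ≡ false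
    lift₁-across a c = liftAdj-nothingʳ K from₁ (from₁-ρ c)

  oneSum-isOneSum : ∀ {G₁ G₂} → IsSimple G₁ → IsSimple G₂ → IsOneSum G₁ G₂ (oneSum G₁ v₁ G₂ v₂)
  oneSum-isOneSum s₁ s₂ = record
    { left   = λ a a′ → trans (cong₂ _∨_ (lift₁-left s₁ a a′) (lift₂-left s₂ a a′)) (∨-identityʳ _)
    ; right  = λ b b′ → cong₂ _∨_ (lift₁-right s₁ b b′) (lift₂-right s₂ b b′)
    ; across = λ {a} c a≢v₁ → cong₂ _∨_ (lift₁-across s₁ a c) (lift₂-across s₂ c a≢v₁) }

  addEdges-isOneSum : ∀ {H₁ H₂ H S} → IsSimple S → IsOneSum H₁ H₂ H →
    IsOneSum H₁ (addEdges H₂ S) (addEdges H (liftAdj S (from₂ v₁ v₂)))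
  addEdges-isOneSum sS os = record
    { left   = λ a a′ → trans (cong₂ _∨_ (left a a′) (lift₂-left sS a a′)) (∨-identityʳ _)
    ; right  = λ b b′ → cong₂ _∨_ (right b b′) (lift₂-right sS b b′)
    ; across = λ c a≢v₁ → cong₂ _∨_ (across c a≢v₁) (lift₂-across sS c a≢v₁) }
    where open IsOneSum os

  isOneSum-connected : ∀ {H₁ H₂ H} → IsOneSum H₁ H₂ H → Connected H₁ → Connected H₂ → Connected H
  isOneSum-connected {H₁} {H₂} {H} os c₁ c₂ x y = reach-trans (to-cut x) (from-cut y)
    where
    open IsOneSum os
    reach₁ : ∀ a a′ → Reach H (ι₁ a) (ι₁ a′)
    reach₁ a a′ = reach-map ι₁ (λ {a} {a′} e → trans (left a a′) e) (c₁ a a′)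
    reach₂ : ∀ b b′ → Reach H (ι₂ b) (ι₂ b′)
    reach₂ b b′ = reach-map ι₂ (λ {b} {b′} e → trans (right b b′) e) (c₂ b b′)
    to-cut : ∀ x → Reach H x (ι₁ v₁)
    to-cut x with split-view x
    ... | inj₁ (a , refl) = reach₁ a v₁
    ... | inj₂ (c , refl) = subst₂ (Reach H) (ι₂-rest₂ c) ι₂-v₂ (reach₂ (rest₂ c) v₂)
    from-cut : ∀ x → Reach H (ι₁ v₁) x
    from-cut x with split-view x
    ... | inj₁ (a , refl) = reach₁ v₁ a
    ... | inj₂ (c , refl) = subst₂ (Reach H) ι₂-v₂ (ι₂-rest₂ c) (reach₂ v₂ (rest₂ c))

  -- Resistances between vertices of the first summand are those of H₁ itself, but they are read off
  -- the pseudoinverse X of the whole graph, since the hypotheses provide no pseudoinverse of L(H₁).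
  leftResistanceSum : Graph n₁ → Mat N → ℚ
  leftResistanceSum H₁ X = Σℚ (λ a → Σℚ (λ a′ → (degℚ H₁ a * degℚ H₁ a′) * resistance X (ι₁ a) (ι₁ a′)))

  leftMoment : Graph n₁ → Mat N → ℚ
  leftMoment H₁ X = Σℚ (λ a → degℚ H₁ a * resistance X (ι₁ a) (ι₁ v₁))

  module Decomposition {H₁ : Graph n₁} {H₂ : Graph (suc k)} {H : Graph N}
      (s₁ : IsSimple H₁) (s₂ : IsSimple H₂) (sH : IsSimple H) (c₁ : Connected H₁) (c₂ : Connected H₂)
      (os : IsOneSum H₁ H₂ H) where
    open IsOneSum os

    m₁ m₂ : ℚ
    m₁ = ℕ→ℚ (edgeCount H₁)
    m₂ = ℕ→ℚ (edgeCount H₂)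

    H-ρ-ι₁ : ∀ {a} c → a ≢ v₁ → H (ρ c) (ι₁ a) ≡ false
    H-ρ-ι₁ c a≢v₁ = trans (IsSimple.symm sH _ _) (across c a≢v₁)

    H-ρ-v₁ : ∀ c → H (ρ c) (ι₁ v₁) ≡ H₂ (rest₂ c) v₂
    H-ρ-v₁ c = trans (cong₂ H (sym (ι₂-rest₂ c)) (sym ι₂-v₂)) (right (rest₂ c) v₂)

    H-v₁-ρ : ∀ c → H (ι₁ v₁) (ρ c) ≡ H₂ v₂ (rest₂ c)
    H-v₁-ρ c = trans (cong₂ H (sym ι₂-v₂) (sym (ι₂-rest₂ c))) (right v₂ (rest₂ c))

    H-ρ-ρ : ∀ c d → H (ρ c) (ρ d) ≡ H₂ (rest₂ c) (rest₂ d)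
    H-ρ-ρ c d = trans (cong₂ H (sym (ι₂-rest₂ c)) (sym (ι₂-rest₂ d))) (right (rest₂ c) (rest₂ d))

    edge-term-cong : ∀ {b b′ : Bool} {p q p′ q′ : ℚ} → b ≡ b′ → p ≡ p′ → q ≡ q′ → 𝟙 b * (p - q) ≡ 𝟙 b′ * (p′ - q′)
    edge-term-cong refl refl refl = refl

    Lap-ρ : ∀ (w : Fin N → ℚ) c → Lap H w (ρ c) ≡ Lap H₂ (λ b → w (ι₂ b)) (rest₂ c)
    Lap-ρ w c = begin
      Lap H w (ρ c)
        ≡⟨ Lap-edgeForm H sH w (ρ c) ⟩
      Σℚ (λ x → 𝟙 (H (ρ c) x) * (w (ρ c) - w x))
        ≡⟨ Σ-N _ ⟩
      Σℚ (λ a → 𝟙 (H (ρ c) (ι₁ a)) * (w (ρ c) - w (ι₁ a))) + Σℚ (λ d → 𝟙 (H (ρ c) (ρ d)) * (w (ρ c) - w (ρ d)))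
        ≡⟨ cong₂ _+_
             (trans (Σℚ-single _ v₁ (λ a a≢v₁ → trans (cong (λ e → 𝟙 e * (w (ρ c) - w (ι₁ a))) (H-ρ-ι₁ c a≢v₁)) (*-zeroˡ (w (ρ c) - w (ι₁ a)))))
                    (edge-term-cong (H-ρ-v₁ c) (cong w (sym (ι₂-rest₂ c))) (cong w (sym ι₂-v₂))))
             (Σℚ-cong (λ d → edge-term-cong (H-ρ-ρ c d) (cong w (sym (ι₂-rest₂ c))) (cong w (sym (ι₂-rest₂ d))))) ⟩
      𝟙 (H₂ (rest₂ c) v₂) * (y (rest₂ c) - y v₂) + Σℚ (λ d → 𝟙 (H₂ (rest₂ c) (rest₂ d)) * (y (rest₂ c) - y (rest₂ d)))
        ≡⟨ sym (Σ-cut (λ b → 𝟙 (H₂ (rest₂ c) b) * (y (rest₂ c) - y b))) ⟩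
      Σℚ (λ b → 𝟙 (H₂ (rest₂ c) b) * (y (rest₂ c) - y b))
        ≡⟨ sym (Lap-edgeForm H₂ s₂ y (rest₂ c)) ⟩
      Lap H₂ y (rest₂ c) ∎
      where
      open ≡-Reasoning
      y = λ b → w (ι₂ b)

    Lap-ι₁ : ∀ (w : Fin N → ℚ) {a} → a ≢ v₁ → Lap H w (ι₁ a) ≡ Lap H₁ (λ a′ → w (ι₁ a′)) a
    Lap-ι₁ w {a} a≢v₁ = begin
      Lap H w (ι₁ a)
        ≡⟨ Lap-edgeForm H sH w (ι₁ a) ⟩
      Σℚ (λ x → 𝟙 (H (ι₁ a) x) * (w (ι₁ a) - w x))
        ≡⟨ Σ-N _ ⟩
      Σℚ (λ a′ → 𝟙 (H (ι₁ a) (ι₁ a′)) * (w (ι₁ a) - w (ι₁ a′))) + Σℚ (λ c → 𝟙 (H (ι₁ a) (ρ c)) * (w (ι₁ a) - w (ρ c)))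
        ≡⟨ cong₂ _+_ (Σℚ-cong (λ a′ → cong (λ e → 𝟙 e * (w (ι₁ a) - w (ι₁ a′))) (left a a′)))
                     (Σℚ-zero (λ c → trans (cong (λ e → 𝟙 e * (w (ι₁ a) - w (ρ c))) (across c a≢v₁)) (*-zeroˡ (w (ι₁ a) - w (ρ c))))) ⟩
      Σℚ (λ a′ → 𝟙 (H₁ a a′) * (w (ι₁ a) - w (ι₁ a′))) + 0ℚ
        ≡⟨ trans (+-identityʳ _) (sym (Lap-edgeForm H₁ s₁ (λ a′ → w (ι₁ a′)) a)) ⟩
      Lap H₁ (λ a′ → w (ι₁ a′)) a ∎
      where open ≡-Reasoning

    Lap-cut : ∀ (w : Fin N → ℚ) → Lap H w (ι₁ v₁) ≡ Lap H₁ (λ a → w (ι₁ a)) v₁ + Lap H₂ (λ b → w (ι₂ b)) v₂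
    Lap-cut w = begin
      Lap H w (ι₁ v₁)
        ≡⟨ Lap-edgeForm H sH w (ι₁ v₁) ⟩
      Σℚ (λ x → 𝟙 (H (ι₁ v₁) x) * (w (ι₁ v₁) - w x))
        ≡⟨ Σ-N _ ⟩
      Σℚ (λ a → 𝟙 (H (ι₁ v₁) (ι₁ a)) * (w (ι₁ v₁) - w (ι₁ a))) + Σℚ (λ c → 𝟙 (H (ι₁ v₁) (ρ c)) * (w (ι₁ v₁) - w (ρ c)))
        ≡⟨ cong₂ _+_ (trans (Σℚ-cong (λ a → cong (λ e → 𝟙 e * (w (ι₁ v₁) - w (ι₁ a))) (left v₁ a)))
                            (sym (Lap-edgeForm H₁ s₁ (λ a → w (ι₁ a)) v₁)))
                     (Σℚ-cong (λ c → edge-term-cong (H-v₁-ρ c) (cong w (sym ι₂-v₂)) (cong w (sym (ι₂-rest₂ c))))) ⟩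
      Lap H₁ (λ a → w (ι₁ a)) v₁ + Σℚ (λ c → 𝟙 (H₂ v₂ (rest₂ c)) * (y v₂ - y (rest₂ c)))
        ≡⟨ cong (Lap H₁ (λ a → w (ι₁ a)) v₁ +_) (begin
             Σℚ (λ c → 𝟙 (H₂ v₂ (rest₂ c)) * (y v₂ - y (rest₂ c)))
               ≡⟨ sym (+-identityˡ _) ⟩
             0ℚ + Σℚ (λ c → 𝟙 (H₂ v₂ (rest₂ c)) * (y v₂ - y (rest₂ c)))
               ≡⟨ cong (_+ Σℚ (λ c → 𝟙 (H₂ v₂ (rest₂ c)) * (y v₂ - y (rest₂ c)))) (sym (𝟙*[p-p] (H₂ v₂ v₂) {y v₂} refl)) ⟩
             𝟙 (H₂ v₂ v₂) * (y v₂ - y v₂) + Σℚ (λ c → 𝟙 (H₂ v₂ (rest₂ c)) * (y v₂ - y (rest₂ c)))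
               ≡⟨ sym (Σ-cut (λ b → 𝟙 (H₂ v₂ b) * (y v₂ - y b))) ⟩
             Σℚ (λ b → 𝟙 (H₂ v₂ b) * (y v₂ - y b))
               ≡⟨ sym (Lap-edgeForm H₂ s₂ y v₂) ⟩
             Lap H₂ y v₂ ∎) ⟩
      Lap H₁ (λ a → w (ι₁ a)) v₁ + Lap H₂ y v₂ ∎
      where
      open ≡-Reasoning
      y = λ b → w (ι₂ b)

    -- The missing equation at the cut vertex comes for free: the entries of a Laplacian image sum to zero.
    left-constant : ∀ (w : Fin N → ℚ) → (∀ {a} → a ≢ v₁ → Lap H w (ι₁ a) ≡ 0ℚ) → ∀ a → w (ι₁ a) ≡ w (ι₁ v₁)
    left-constant w Lw≡0 a = Lap≡0⇒constant H₁ s₁ c₁ y Ly≡0 a v₁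
      where
      y = λ a → w (ι₁ a)
      off-cut : ∀ {a} → a ≢ v₁ → Lap H₁ y a ≡ 0ℚ
      off-cut a≢v₁ = trans (sym (Lap-ι₁ w a≢v₁)) (Lw≡0 a≢v₁)
      Ly≡0 : ∀ a → Lap H₁ y a ≡ 0ℚ
      Ly≡0 a with a ≟ v₁
      ... | yes refl = trans (sym (Σℚ-single (Lap H₁ y) v₁ (λ _ → off-cut))) (Σ-Lap≡0 H₁ s₁ y)
      ... | no a≢v₁  = off-cut a≢v₁

    right-constant : ∀ (w : Fin N → ℚ) → (∀ c → Lap H w (ρ c) ≡ 0ℚ) → ∀ b → w (ι₂ b) ≡ w (ι₁ v₁)
    right-constant w Lw≡0 b = trans (Lap≡0⇒constant H₂ s₂ c₂ y Ly≡0 b v₂) (cong w ι₂-v₂)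
      where
      y = λ b → w (ι₂ b)
      off-cut : ∀ c → Lap H₂ y (rest₂ c) ≡ 0ℚ
      off-cut c = trans (sym (Lap-ρ w c)) (Lw≡0 c)
      Ly≡0 : ∀ b → Lap H₂ y b ≡ 0ℚ
      Ly≡0 b with cut-view b
      ... | inj₁ refl = begin
        Lap H₂ y v₂                                       ≡⟨ sym (+-identityʳ _) ⟩
        Lap H₂ y v₂ + 0ℚ                                  ≡⟨ cong (Lap H₂ y v₂ +_) (sym (Σℚ-zero off-cut)) ⟩
        Lap H₂ y v₂ + Σℚ (λ c → Lap H₂ y (rest₂ c))      ≡⟨ sym (Σ-cut (Lap H₂ y)) ⟩
        Σℚ (Lap H₂ y)                                     ≡⟨ Σ-Lap≡0 H₂ s₂ y ⟩
        0ℚ                                                ∎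
        where open ≡-Reasoning
      ... | inj₂ (c , refl) = off-cut c

    Lap-ι₂ : ∀ (w : Fin N → ℚ) → (∀ a → w (ι₁ a) ≡ w (ι₁ v₁)) → ∀ p → Lap H w (ι₂ p) ≡ Lap H₂ (λ b → w (ι₂ b)) p
    Lap-ι₂ w left-flat p with cut-view p
    ... | inj₂ (c , refl) = trans (cong (Lap H w) (ι₂-rest₂ c)) (Lap-ρ w c)
    ... | inj₁ refl = begin
      Lap H w (ι₂ v₂)                                                 ≡⟨ cong (Lap H w) ι₂-v₂ ⟩
      Lap H w (ι₁ v₁)                                                 ≡⟨ Lap-cut w ⟩
      Lap H₁ (λ a → w (ι₁ a)) v₁ + Lap H₂ (λ b → w (ι₂ b)) v₂         ≡⟨ cong (_+ Lap H₂ (λ b → w (ι₂ b)) v₂) (Lap-constant H₁ s₁ _ left-flat v₁) ⟩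
      0ℚ + Lap H₂ (λ b → w (ι₂ b)) v₂                                 ≡⟨ +-identityˡ _ ⟩
      Lap H₂ (λ b → w (ι₂ b)) v₂                                      ∎
      where open ≡-Reasoning

    degℚ-ι₁ : ∀ a → degℚ H (ι₁ a) ≡ degℚ H₁ a + δ a v₁ * degℚ H₂ v₂
    degℚ-ι₁ a = begin
      degℚ H (ι₁ a)
        ≡⟨ trans (degℚ≡Σ𝟙 H (ι₁ a)) (Σ-N _) ⟩
      Σℚ (λ a′ → 𝟙 (H (ι₁ a) (ι₁ a′))) + Σℚ (λ c → 𝟙 (H (ι₁ a) (ρ c)))
        ≡⟨ cong₂ _+_ (trans (Σℚ-cong (λ a′ → cong 𝟙 (left a a′))) (sym (degℚ≡Σ𝟙 H₁ a))) (to-right a) ⟩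
      degℚ H₁ a + δ a v₁ * degℚ H₂ v₂ ∎
      where
      open ≡-Reasoning
      to-right : ∀ a → Σℚ (λ c → 𝟙 (H (ι₁ a) (ρ c))) ≡ δ a v₁ * degℚ H₂ v₂
      to-right a with a ≟ v₁
      ... | no a≢v₁  = trans (Σℚ-zero (λ c → cong 𝟙 (across c a≢v₁))) (sym (*-zeroˡ (degℚ H₂ v₂)))
      ... | yes refl = begin
        Σℚ (λ c → 𝟙 (H (ι₁ v₁) (ρ c)))                     ≡⟨ Σℚ-cong (λ c → cong 𝟙 (H-v₁-ρ c)) ⟩
        Σℚ (λ c → 𝟙 (H₂ v₂ (rest₂ c)))                     ≡⟨ sym (+-identityˡ _) ⟩
        0ℚ + Σℚ (λ c → 𝟙 (H₂ v₂ (rest₂ c)))                ≡⟨ cong (λ e → 𝟙 e + Σℚ (λ c → 𝟙 (H₂ v₂ (rest₂ c)))) (sym (IsSimple.irrefl s₂ v₂)) ⟩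
        𝟙 (H₂ v₂ v₂) + Σℚ (λ c → 𝟙 (H₂ v₂ (rest₂ c)))      ≡⟨ sym (Σ-cut (λ b → 𝟙 (H₂ v₂ b))) ⟩
        Σℚ (λ b → 𝟙 (H₂ v₂ b))                             ≡⟨ sym (trans (*-identityˡ _) (degℚ≡Σ𝟙 H₂ v₂)) ⟩
        1ℚ * degℚ H₂ v₂                                    ∎

    degℚ-ρ : ∀ c → degℚ H (ρ c) ≡ degℚ H₂ (rest₂ c)
    degℚ-ρ c = begin
      degℚ H (ρ c)
        ≡⟨ trans (degℚ≡Σ𝟙 H (ρ c)) (Σ-N _) ⟩
      Σℚ (λ a → 𝟙 (H (ρ c) (ι₁ a))) + Σℚ (λ d → 𝟙 (H (ρ c) (ρ d)))
        ≡⟨ cong₂ _+_ (trans (Σℚ-single (λ a → 𝟙 (H (ρ c) (ι₁ a))) v₁ (λ a a≢v₁ → cong 𝟙 (H-ρ-ι₁ c a≢v₁))) (cong 𝟙 (H-ρ-v₁ c)))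
                     (Σℚ-cong (λ d → cong 𝟙 (H-ρ-ρ c d))) ⟩
      𝟙 (H₂ (rest₂ c) v₂) + Σℚ (λ d → 𝟙 (H₂ (rest₂ c) (rest₂ d)))
        ≡⟨ sym (trans (degℚ≡Σ𝟙 H₂ (rest₂ c)) (Σ-cut (λ b → 𝟙 (H₂ (rest₂ c) b)))) ⟩
      degℚ H₂ (rest₂ c) ∎
      where open ≡-Reasoning

    Σ-degree-weighted : ∀ (f : Fin N → ℚ) →
      Σℚ (λ x → degℚ H x * f x) ≡ Σℚ (λ a → degℚ H₁ a * f (ι₁ a)) + Σℚ (λ b → degℚ H₂ b * f (ι₂ b))
    Σ-degree-weighted f = begin
      Σℚ (λ x → degℚ H x * f x)
        ≡⟨ Σ-N _ ⟩
      Σℚ (λ a → degℚ H (ι₁ a) * f (ι₁ a)) + Σℚ (λ c → degℚ H (ρ c) * f (ρ c))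
        ≡⟨ cong₂ _+_ left-part (Σℚ-cong (λ c → cong₂ _*_ (degℚ-ρ c) (cong f (sym (ι₂-rest₂ c))))) ⟩
      (Σℚ (λ a → degℚ H₁ a * f (ι₁ a)) + degℚ H₂ v₂ * f (ι₂ v₂)) + Σℚ (λ c → degℚ H₂ (rest₂ c) * f (ι₂ (rest₂ c)))
        ≡⟨ trans (+-assoc (Σℚ (λ a → degℚ H₁ a * f (ι₁ a))) (degℚ H₂ v₂ * f (ι₂ v₂)) _)
                 (cong (Σℚ (λ a → degℚ H₁ a * f (ι₁ a)) +_) (sym (Σ-cut (λ b → degℚ H₂ b * f (ι₂ b))))) ⟩
      Σℚ (λ a → degℚ H₁ a * f (ι₁ a)) + Σℚ (λ b → degℚ H₂ b * f (ι₂ b)) ∎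
      where
      open ≡-Reasoning
      left-part : Σℚ (λ a → degℚ H (ι₁ a) * f (ι₁ a)) ≡ Σℚ (λ a → degℚ H₁ a * f (ι₁ a)) + degℚ H₂ v₂ * f (ι₂ v₂)
      left-part = begin
        Σℚ (λ a → degℚ H (ι₁ a) * f (ι₁ a))
          ≡⟨ Σℚ-cong (λ a → trans (cong (_* f (ι₁ a)) (degℚ-ι₁ a))
               (solve 4 (λ d e g y → (d :+ e :* g) :* y := d :* y :+ e :* (g :* y)) refl (degℚ H₁ a) (δ a v₁) (degℚ H₂ v₂) (f (ι₁ a)))) ⟩
        Σℚ (λ a → degℚ H₁ a * f (ι₁ a) + δ a v₁ * (degℚ H₂ v₂ * f (ι₁ a)))
          ≡⟨ Σℚ-distrib-+ (λ a → degℚ H₁ a * f (ι₁ a)) (λ a → δ a v₁ * (degℚ H₂ v₂ * f (ι₁ a))) ⟩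
        Σℚ (λ a → degℚ H₁ a * f (ι₁ a)) + Σℚ (λ a → δ a v₁ * (degℚ H₂ v₂ * f (ι₁ a)))
          ≡⟨ cong (Σℚ (λ a → degℚ H₁ a * f (ι₁ a)) +_)
               (trans (Σℚ-cong (λ a → cong (_* (degℚ H₂ v₂ * f (ι₁ a))) (δ-sym a v₁))) (Σℚ-δ v₁ (λ a → degℚ H₂ v₂ * f (ι₁ a)))) ⟩
        Σℚ (λ a → degℚ H₁ a * f (ι₁ a)) + degℚ H₂ v₂ * f (ι₁ v₁)
          ≡⟨ cong (λ x → Σℚ (λ a → degℚ H₁ a * f (ι₁ a)) + degℚ H₂ v₂ * f x) (sym ι₂-v₂) ⟩
        Σℚ (λ a → degℚ H₁ a * f (ι₁ a)) + degℚ H₂ v₂ * f (ι₂ v₂) ∎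

    edgeCount-oneSum : edgeCount H ≡ edgeCount H₁ ℕ.+ edgeCount H₂
    edgeCount-oneSum = ℕ→ℚ-injective (p+p≡q+q⇒p≡q (begin
      ℕ→ℚ (edgeCount H) + ℕ→ℚ (edgeCount H)
        ≡⟨ handshake H sH ⟩
      Σℚ (degℚ H)
        ≡⟨ trans (Σℚ-cong (λ x → sym (*-identityʳ (degℚ H x)))) (Σ-degree-weighted (λ _ → 1ℚ)) ⟩
      Σℚ (λ a → degℚ H₁ a * 1ℚ) + Σℚ (λ b → degℚ H₂ b * 1ℚ)
        ≡⟨ cong₂ _+_ (trans (Σℚ-cong (λ a → *-identityʳ (degℚ H₁ a))) (sym (handshake H₁ s₁)))
                     (trans (Σℚ-cong (λ b → *-identityʳ (degℚ H₂ b))) (sym (handshake H₂ s₂))) ⟩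
      (m₁ + m₁) + (m₂ + m₂)
        ≡⟨ solve 2 (λ a b → (a :+ a) :+ (b :+ b) := (a :+ b) :+ (a :+ b)) refl m₁ m₂ ⟩
      (m₁ + m₂) + (m₁ + m₂)
        ≡⟨ cong (λ z → z + z) (sym (ℕ→ℚ-+ (edgeCount H₁) (edgeCount H₂))) ⟩
      ℕ→ℚ (edgeCount H₁ ℕ.+ edgeCount H₂) + ℕ→ℚ (edgeCount H₁ ℕ.+ edgeCount H₂) ∎))
      where open ≡-Reasoning

    Σ-degree-weighted² : ∀ (f : Fin N → Fin N → ℚ) →
      Σℚ (λ x → degℚ H x * Σℚ (λ y → degℚ H y * f x y)) ≡
        (Σℚ (λ a → degℚ H₁ a * Σℚ (λ a′ → degℚ H₁ a′ * f (ι₁ a) (ι₁ a′))) + Σℚ (λ a → degℚ H₁ a * Σℚ (λ b → degℚ H₂ b * f (ι₁ a) (ι₂ b))))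
      + (Σℚ (λ b → degℚ H₂ b * Σℚ (λ a → degℚ H₁ a * f (ι₂ b) (ι₁ a))) + Σℚ (λ b → degℚ H₂ b * Σℚ (λ b′ → degℚ H₂ b′ * f (ι₂ b) (ι₂ b′))))
    Σ-degree-weighted² f = trans (Σ-degree-weighted (λ x → Σℚ (λ y → degℚ H y * f x y)))
      (cong₂ _+_ (split-inner (degℚ H₁) ι₁) (split-inner (degℚ H₂) ι₂))
      where
      split-inner : ∀ {m} (d : Fin m → ℚ) (ι : Fin m → Fin N) →
        Σℚ (λ i → d i * Σℚ (λ y → degℚ H y * f (ι i) y)) ≡
          Σℚ (λ i → d i * Σℚ (λ a → degℚ H₁ a * f (ι i) (ι₁ a))) + Σℚ (λ i → d i * Σℚ (λ b → degℚ H₂ b * f (ι i) (ι₂ b)))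
      split-inner d ι = trans
        (Σℚ-cong (λ i → trans (cong (d i *_) (Σ-degree-weighted (f (ι i)))) (*-distribˡ-+ (d i) _ _)))
        (Σℚ-distrib-+ (λ i → d i * Σℚ (λ a → degℚ H₁ a * f (ι i) (ι₁ a))) (λ i → d i * Σℚ (λ b → degℚ H₂ b * f (ι i) (ι₂ b))))

    module _ (cH : Connected H) (X : Mat N) (pX : IsPseudoinverse (laplacian H) X) where
      private
        R = resistance X
        φ = potential H sH cH X pX
        Lap-φ = Lap-potential H sH cH X pX

      φ-left-right-constant : ∀ a a′ b → φ (ι₁ a) (ι₁ a′) (ι₂ b) ≡ φ (ι₁ a) (ι₁ a′) (ι₁ v₁)
      φ-left-right-constant a a′ = right-constant (φ (ι₁ a) (ι₁ a′))
        (λ c → trans (Lap-φ (ι₁ a) (ι₁ a′) (ρ c)) (trans (cong₂ _-_ (δ-ρ-ι₁ c a) (δ-ρ-ι₁ c a′)) (+-inverseʳ 0ℚ)))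

      φ-right-left-constant : ∀ p q a → φ (ι₂ p) (ι₂ q) (ι₁ a) ≡ φ (ι₂ p) (ι₂ q) (ι₁ v₁)
      φ-right-left-constant p q = left-constant (φ (ι₂ p) (ι₂ q))
        (λ {a} a≢v₁ → trans (Lap-φ (ι₂ p) (ι₂ q) (ι₁ a))
           (trans (cong₂ _-_ (δ-≢ (ι₁≢ι₂ p a≢v₁)) (δ-≢ (ι₁≢ι₂ q a≢v₁))) (+-inverseʳ 0ℚ)))

      -- The current from ι₁ a to ι₂ b is the sum of the currents ι₁ a → v₁ and v₁ → ι₂ b, and each of
      -- their potentials is constant on the side of the cut not containing its source and sink.
      resistance-across : ∀ a b → R (ι₁ a) (ι₂ b) ≡ R (ι₁ a) (ι₁ v₁) + R (ι₁ v₁) (ι₂ b)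
      resistance-across a b = begin
        R (ι₁ a) (ι₂ b)
          ≡⟨ resistance-by-potential H sH cH X pX (ι₁ a) (ι₂ b) (λ x → u₁ x + u₂ x) Lu₁+u₂ ⟩
        (u₁ (ι₁ a) + u₂ (ι₁ a)) - (u₁ (ι₂ b) + u₂ (ι₂ b))
          ≡⟨ cong₂ (λ p q → (u₁ (ι₁ a) + p) - (q + u₂ (ι₂ b))) u₂-left u₁-right ⟩
        (u₁ (ι₁ a) + u₂ (ι₁ v₁)) - (u₁ (ι₁ v₁) + u₂ (ι₂ b))
          ≡⟨ solve 4 (λ p q r s → (p :+ q) :- (r :+ s) := (p :- r) :+ (q :- s)) refl (u₁ (ι₁ a)) (u₂ (ι₁ v₁)) (u₁ (ι₁ v₁)) (u₂ (ι₂ b)) ⟩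
        (u₁ (ι₁ a) - u₁ (ι₁ v₁)) + (u₂ (ι₁ v₁) - u₂ (ι₂ b))
          ≡⟨ sym (cong₂ _+_ (resistance≡potential H sH cH X pX (ι₁ a) (ι₁ v₁)) (resistance≡potential H sH cH X pX (ι₁ v₁) (ι₂ b))) ⟩
        R (ι₁ a) (ι₁ v₁) + R (ι₁ v₁) (ι₂ b) ∎
        where
        open ≡-Reasoning
        u₁ = φ (ι₁ a) (ι₁ v₁)
        u₂ = φ (ι₁ v₁) (ι₂ b)
        u₁-right : u₁ (ι₂ b) ≡ u₁ (ι₁ v₁)
        u₁-right = φ-left-right-constant a v₁ b
        u₂-left : u₂ (ι₁ a) ≡ u₂ (ι₁ v₁)
        u₂-left = trans (cong (λ x → φ x (ι₂ b) (ι₁ a)) (sym ι₂-v₂))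
                  (trans (φ-right-left-constant v₂ b a) (cong (λ x → φ x (ι₂ b) (ι₁ v₁)) ι₂-v₂))
        Lu₁+u₂ : ∀ x → Lap H (λ y → u₁ y + u₂ y) x ≡ δ x (ι₁ a) - δ x (ι₂ b)
        Lu₁+u₂ x = trans (Lap-distrib-+ H u₁ u₂ x) (trans (cong₂ _+_ (Lap-φ (ι₁ a) (ι₁ v₁) x) (Lap-φ (ι₁ v₁) (ι₂ b) x))
          (solve 3 (λ p q r → (p :- q) :+ (q :- r) := p :- r) refl (δ x (ι₁ a)) (δ x (ι₁ v₁)) (δ x (ι₂ b))))

      resistance-right : ∀ (Y : Mat (suc k)) → IsPseudoinverse (laplacian H₂) Y → ∀ p q → R (ι₂ p) (ι₂ q) ≡ resistance Y p q
      resistance-right Y pY p q = trans (resistance≡potential H sH cH X pX (ι₂ p) (ι₂ q))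
        (sym (resistance-by-potential H₂ s₂ c₂ Y pY p q (λ b → u (ι₂ b))
          (λ b → trans (sym (Lap-ι₂ u (φ-right-left-constant p q) b))
                       (trans (Lap-φ (ι₂ p) (ι₂ q) (ι₂ b)) (cong₂ _-_ (δ-ι₂ b p) (δ-ι₂ b q))))))
        where
        u = φ (ι₂ p) (ι₂ q)

      module _ (Y : Mat (suc k)) (pY : IsPseudoinverse (laplacian H₂) Y) where
        private
          d₁ = degℚ H₁
          d₂ = degℚ H₂
          μ₁ = leftMoment H₁ X
          μ₂ = moment H₂ Y v₂
          cross-term = Σℚ d₂ * μ₁ + Σℚ d₁ * μ₂

        resistance-across-Y : ∀ a b → R (ι₁ a) (ι₂ b) ≡ R (ι₁ a) (ι₁ v₁) + resistance Y b v₂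
        resistance-across-Y a b = trans (resistance-across a b) (cong (R (ι₁ a) (ι₁ v₁) +_)
          (trans (cong (λ x → R x (ι₂ b)) (sym ι₂-v₂)) (trans (resistance-right Y pY v₂ b) (resistance-sym Y v₂ b))))

        degreeResistanceSum-oneSum :
          degreeResistanceSum H X ≡ (leftResistanceSum H₁ X + degreeResistanceSum H₂ Y) + (cross-term + cross-term)
        degreeResistanceSum-oneSum = begin
          degreeResistanceSum H X
            ≡⟨ Σℚ²-factor (degℚ H) (degℚ H) R ⟩
          Σℚ (λ x → degℚ H x * Σℚ (λ y → degℚ H y * R x y))
            ≡⟨ Σ-degree-weighted² R ⟩
          (Σℚ (λ a → d₁ a * Σℚ (λ a′ → d₁ a′ * R (ι₁ a) (ι₁ a′))) + Σℚ (λ a → d₁ a * Σℚ (λ b → d₂ b * R (ι₁ a) (ι₂ b))))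
            + (Σℚ (λ b → d₂ b * Σℚ (λ a → d₁ a * R (ι₂ b) (ι₁ a))) + Σℚ (λ b → d₂ b * Σℚ (λ b′ → d₂ b′ * R (ι₂ b) (ι₂ b′))))
            ≡⟨ cong₂ _+_ (cong₂ _+_ (sym (Σℚ²-factor d₁ d₁ (λ a a′ → R (ι₁ a) (ι₁ a′)))) left-right)
                         (cong₂ _+_ right-left right-right) ⟩
          (leftResistanceSum H₁ X + cross-term) + (cross-term + degreeResistanceSum H₂ Y)
            ≡⟨ solve 3 (λ s t u → (s :+ u) :+ (u :+ t) := (s :+ t) :+ (u :+ u)) refl
                       (leftResistanceSum H₁ X) (degreeResistanceSum H₂ Y) cross-term ⟩
          (leftResistanceSum H₁ X + degreeResistanceSum H₂ Y) + (cross-term + cross-term) ∎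
          where
          open ≡-Reasoning
          left-right : Σℚ (λ a → d₁ a * Σℚ (λ b → d₂ b * R (ι₁ a) (ι₂ b))) ≡ cross-term
          left-right = trans (Σℚ-cong (λ a → cong (d₁ a *_) (Σℚ-cong (λ b → cong (d₂ b *_) (resistance-across-Y a b)))))
                             (Σℚ-separable d₁ d₂ (λ a → R (ι₁ a) (ι₁ v₁)) (λ b → resistance Y b v₂))
          right-left : Σℚ (λ b → d₂ b * Σℚ (λ a → d₁ a * R (ι₂ b) (ι₁ a))) ≡ cross-term
          right-left = trans (Σℚ-cong (λ b → cong (d₂ b *_) (Σℚ-cong (λ a → cong (d₁ a *_)
                               (trans (resistance-sym X (ι₂ b) (ι₁ a)) (trans (resistance-across-Y a b) (+-comm (R (ι₁ a) (ι₁ v₁)) (resistance Y b v₂))))))))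
                             (trans (Σℚ-separable d₂ d₁ (λ b → resistance Y b v₂) (λ a → R (ι₁ a) (ι₁ v₁))) (+-comm (Σℚ d₁ * μ₂) (Σℚ d₂ * μ₁)))
          right-right : Σℚ (λ b → d₂ b * Σℚ (λ b′ → d₂ b′ * R (ι₂ b) (ι₂ b′))) ≡ degreeResistanceSum H₂ Y
          right-right = trans (Σℚ-cong (λ b → cong (d₂ b *_) (Σℚ-cong (λ b′ → cong (d₂ b′ *_) (resistance-right Y pY b b′)))))
                              (sym (Σℚ²-factor d₂ d₂ (resistance Y)))

        kemeny-oneSum : 1 ℕ.≤ edgeCount H₂ →
          kemeny H X * (ℕ→ℚ 4 * (m₁ + m₂)) ≡ (leftResistanceSum H₁ X + kemeny H₂ Y * (ℕ→ℚ 4 * m₂))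
            + (((m₂ + m₂) * μ₁ + (m₁ + m₁) * μ₂) + ((m₂ + m₂) * μ₁ + (m₁ + m₁) * μ₂))
        kemeny-oneSum m₂≥1 = begin
          kemeny H X * (ℕ→ℚ 4 * (m₁ + m₂))
            ≡⟨ cong (λ m → kemeny H X * (ℕ→ℚ 4 * m)) (sym (trans (cong ℕ→ℚ edgeCount-oneSum) (ℕ→ℚ-+ (edgeCount H₁) (edgeCount H₂)))) ⟩
          kemeny H X * (ℕ→ℚ 4 * ℕ→ℚ (edgeCount H))
            ≡⟨ kemeny-*-4m H X (subst (1 ℕ.≤_) (sym edgeCount-oneSum) (ℕ.≤-trans m₂≥1 (ℕ.m≤n+m (edgeCount H₂) (edgeCount H₁)))) ⟩
          degreeResistanceSum H X
            ≡⟨ degreeResistanceSum-oneSum ⟩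
          (leftResistanceSum H₁ X + degreeResistanceSum H₂ Y) + (cross-term + cross-term)
            ≡⟨ cong₂ (λ t c → (leftResistanceSum H₁ X + t) + (c + c)) (sym (kemeny-*-4m H₂ Y m₂≥1))
                     (cong₂ (λ D₂ D₁ → D₂ * μ₁ + D₁ * μ₂) (sym (handshake H₂ s₂)) (sym (handshake H₁ s₁))) ⟩
          (leftResistanceSum H₁ X + kemeny H₂ Y * (ℕ→ℚ 4 * m₂)) + (((m₂ + m₂) * μ₁ + (m₁ + m₁) * μ₂) + ((m₂ + m₂) * μ₁ + (m₁ + m₁) * μ₂)) ∎
          where open ≡-Reasoning

      leftMoment-bound : 0ℚ ≤ ((m₁ + m₁) * leftMoment H₁ X + (m₁ + m₁) * leftMoment H₁ X) - leftResistanceSum H₁ X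
      leftMoment-bound = subst (0ℚ ≤_)
        (trans (cong₂ (λ D B → (D * B + D * B) - Σℚ (λ x → Σℚ (λ y → (t x * t y) * R x y))) Σt≡2m₁ (Σ-extend (λ x → R x (ι₁ v₁))))
               (cong (λ A → ((m₁ + m₁) * leftMoment H₁ X + (m₁ + m₁) * leftMoment H₁ X) - A) Σtt≡S₁))
        (weighted-resistance-bound H sH cH X pX (ι₁ v₁) t)
        where
        t : Fin N → ℚ
        t x = [ degℚ H₁ , (λ _ → 0ℚ) ]′ (splitAt n₁ x)
        Σ-extend : ∀ (g : Fin N → ℚ) → Σℚ (λ x → t x * g x) ≡ Σℚ (λ a → degℚ H₁ a * g (ι₁ a))
        Σ-extend g = trans (Σ-N (λ x → t x * g x)) (trans
          (cong₂ _+_ (Σℚ-cong (λ a → cong (λ s → [ degℚ H₁ , (λ _ → 0ℚ) ]′ s * g (ι₁ a)) (splitAt-↑ˡ n₁ a k)))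
                     (Σℚ-zero (λ c → trans (cong (λ s → [ degℚ H₁ , (λ _ → 0ℚ) ]′ s * g (ρ c)) (splitAt-↑ʳ n₁ k c)) (*-zeroˡ (g (ρ c))))))
          (+-identityʳ _))
        Σt≡2m₁ : Σℚ t ≡ m₁ + m₁
        Σt≡2m₁ = trans (Σℚ-cong (λ x → sym (*-identityʳ (t x)))) (trans (Σ-extend (λ _ → 1ℚ))
                   (trans (Σℚ-cong (λ a → *-identityʳ (degℚ H₁ a))) (sym (handshake H₁ s₁))))
        Σtt≡S₁ : Σℚ (λ x → Σℚ (λ y → (t x * t y) * R x y)) ≡ leftResistanceSum H₁ X
        Σtt≡S₁ = trans (Σℚ²-factor t t R) (trans (Σ-extend (λ x → Σℚ (λ y → t y * R x y)))
                   (trans (Σℚ-cong (λ a → cong (degℚ H₁ a *_) (Σ-extend (R (ι₁ a))))) (sym (Σℚ²-factor (degℚ H₁) (degℚ H₁) (λ a a′ → R (ι₁ a) (ι₁ a′))))))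

      module _ {S : Graph (suc k)} (sS : IsSimple S) (X̂ : Mat N)
               (ĉ : Connected (addEdges H (liftAdj S (from₂ v₁ v₂))))
               (pX̂ : IsPseudoinverse (laplacian (addEdges H (liftAdj S (from₂ v₁ v₂)))) X̂) where

        -- The potential of a current between two vertices of H₁ is constant on the H₂ side,
        -- so the added edges carry no current.
        resistance-left-addEdges : ∀ a a′ → resistance X̂ (ι₁ a) (ι₁ a′) ≡ R (ι₁ a) (ι₁ a′)
        resistance-left-addEdges a a′ = trans
          (resistance-by-potential (addEdges H S↑) (addEdges-simple sH sS↑) ĉ X̂ pX̂ (ι₁ a) (ι₁ a′) u
            (λ x → trans (Lap-addEdges-flat u sH sS↑ flat x) (Lap-φ (ι₁ a) (ι₁ a′) x)))
          (sym (resistance≡potential H sH cH X pX (ι₁ a) (ι₁ a′)))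
          where
          S↑ = liftAdj S (from₂ v₁ v₂)
          sS↑ = liftAdj-simple S (from₂ v₁ v₂) sS
          u = φ (ι₁ a) (ι₁ a′)
          flat : ∀ {x y} → S↑ x y ≡ true → u x ≡ u y
          flat e with liftAdj-true S (from₂ v₁ v₂) e
          ... | (p , from-x) , (q , from-y) =
            trans (cong u (from₂-just from-x)) (trans (φ-left-right-constant a a′ p)
              (sym (trans (cong u (from₂-just from-y)) (φ-left-right-constant a a′ q))))

        leftResistanceSum-addEdges : leftResistanceSum H₁ X̂ ≡ leftResistanceSum H₁ X
        leftResistanceSum-addEdges =
          Σℚ-cong (λ a → Σℚ-cong (λ a′ → cong (degℚ H₁ a * degℚ H₁ a′ *_) (resistance-left-addEdges a a′)))

        leftMoment-addEdges : leftMoment H₁ X̂ ≡ leftMoment H₁ X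
        leftMoment-addEdges = Σℚ-cong (λ a → cong (degℚ H₁ a *_) (resistance-left-addEdges a v₁))

  module AddEdges {H₁ : Graph n₁} {H₂ S : Graph (suc k)} {H : Graph N}
      (s₁ : IsSimple H₁) (s₂ : IsSimple H₂) (sS : IsSimple S) (sH : IsSimple H)
      (c₁ : Connected H₁) (c₂ : Connected H₂) (os : IsOneSum H₁ H₂ H)
      (S-new : ∀ {b b′} → S b b′ ≡ true → H₂ b b′ ≡ false) where
    Ĥ₂ : Graph (suc k)
    Ĥ₂ = addEdges H₂ S

    Ĥ : Graph N
    Ĥ = addEdges H (liftAdj S (from₂ v₁ v₂))

    private
      ĉ₂ : Connected Ĥ₂
      ĉ₂ = addEdges-connected S c₂
      ôs : IsOneSum H₁ Ĥ₂ Ĥ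
      ôs = addEdges-isOneSum sS os
      module D = Decomposition s₁ s₂ sH c₁ c₂ os
      module D̂ = Decomposition s₁ (addEdges-simple s₂ sS) (addEdges-simple sH (liftAdj-simple S (from₂ v₁ v₂) sS)) c₁ ĉ₂ ôs

    kemeny-increases : 1 ℕ.≤ edgeCount H₁ → 1 ℕ.≤ edgeCount H₂ →
      ∀ (X X̂ : Mat N) (Y Ŷ : Mat (suc k)) →
      IsPseudoinverse (laplacian H) X → IsPseudoinverse (laplacian Ĥ) X̂ →
      IsPseudoinverse (laplacian H₂) Y → IsPseudoinverse (laplacian Ĥ₂) Ŷ →
      let m₁ = ℕ→ℚ (edgeCount H₁)
          m₂ = ℕ→ℚ (edgeCount H₂)
          l  = ℕ→ℚ (edgeCount S)
          A = moment Ĥ₂ Ŷ v₂ - moment H₂ Y v₂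
          B = kemeny Ĥ₂ Ŷ - moment H₂ Y v₂
          C = kemeny Ĥ₂ Ŷ - kemeny H₂ Y
      in
      0ℚ < ((A * (m₁ * m₁) + ((A + C) * m₂ + B * l) * m₁) + C * (m₂ * m₂ + l * m₂)) →
      kemeny H X < kemeny Ĥ X̂
    kemeny-increases m₁≥1 m₂≥1 X X̂ Y Ŷ pX pX̂ pY pŶ E>0 =
      <-from-positive-gap (*-pos (4[m₁+_]>0 (ℕ→ℚ-nonNeg (edgeCount H₂))) (4[m₁+_]>0 (ℕ→ℚ-nonNeg (edgeCount Ĥ₂))))
        (kemeny-gap-identity (kemeny H X) (kemeny Ĥ X̂) (kemeny H₂ Y) (kemeny Ĥ₂ Ŷ)
           (leftResistanceSum H₁ X) (leftResistanceSum H₁ X̂) (leftMoment H₁ X) (leftMoment H₁ X̂)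
           (moment H₂ Y v₂) (moment Ĥ₂ Ŷ v₂) D.m₁ D.m₂ D̂.m₂ l
           (D.leftResistanceSum-addEdges cH X pX sS X̂ cĤ pX̂) (D.leftMoment-addEdges cH X pX sS X̂ cĤ pX̂) m̂₂≡m₂+l
           (D.kemeny-oneSum cH X pX Y pY m₂≥1) (D̂.kemeny-oneSum cĤ X̂ pX̂ Ŷ pŶ m̂₂≥1))
        (+-pos-nonNeg (*-pos (ℕ→ℚ-pos {16} (ℕ.s≤s ℕ.z≤n)) E>0)
                      (*-nonNeg (*-nonNeg (ℕ→ℚ-nonNeg 4) (ℕ→ℚ-nonNeg (edgeCount S))) (D.leftMoment-bound cH X pX)))
      where
      l = ℕ→ℚ (edgeCount S)
      cH = isOneSum-connected os c₁ c₂
      cĤ = isOneSum-connected ôs c₁ ĉ₂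
      edgeCount-Ĥ₂ : edgeCount Ĥ₂ ≡ edgeCount H₂ ℕ.+ edgeCount S
      edgeCount-Ĥ₂ = edgeCount-addEdges (λ {b} {b′} → S-new {b} {b′})
      m̂₂≡m₂+l : D̂.m₂ ≡ D.m₂ + l
      m̂₂≡m₂+l = trans (cong ℕ→ℚ edgeCount-Ĥ₂) (ℕ→ℚ-+ (edgeCount H₂) (edgeCount S))
      m̂₂≥1 : 1 ℕ.≤ edgeCount Ĥ₂
      m̂₂≥1 = subst (1 ℕ.≤_) (sym edgeCount-Ĥ₂) (ℕ.≤-trans m₂≥1 (ℕ.m≤m+n (edgeCount H₂) (edgeCount S)))
      4[m₁+_]>0 : ∀ {x} → 0ℚ ≤ x → 0ℚ < ℕ→ℚ 4 * (D.m₁ + x)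
      4[m₁+_]>0 x≥0 = *-pos (ℕ→ℚ-pos {4} (ℕ.s≤s ℕ.z≤n)) (+-pos-nonNeg (ℕ→ℚ-pos m₁≥1) x≥0)

corollary4p3 :
  ∀ {n₁ k : ℕ} (G₁ : Graph n₁) (v₁ : Fin n₁) (G₂ : Graph (suc k)) (v₂ : Fin (suc k)) →
  IsSimple G₁ → IsSimple G₂ → Connected G₁ → Connected G₂ →
  1 ℕ.≤ edgeCount G₁ → 1 ℕ.≤ edgeCount G₂ →
  (𝓛 : Graph (suc k)) → IsSimple 𝓛 →
  (∀ (x y : Fin (n₁ ℕ.+ k)) (a b : Fin (suc k)) →
    from₂ v₁ v₂ x ≡ just a → from₂ v₁ v₂ y ≡ just b → 𝓛 a b ≡ true →
    oneSum {n₁} {k} G₁ v₁ G₂ v₂ x y ≡ false) →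
  let G   = oneSum {n₁} {k} G₁ v₁ G₂ v₂
      Ĝ   = addEdges G (liftAdj 𝓛 (from₂ v₁ v₂))
      Ĝ₂  = addEdges G₂ 𝓛
      m₁  = ℕ→ℚ (edgeCount G₁)
      m₂  = ℕ→ℚ (edgeCount G₂)
      l   = ℕ→ℚ (edgeCount 𝓛)
  in
  ∀ (X Xhat : Mat (n₁ ℕ.+ k)) (X₂ X₂hat : Mat (suc k)) →
  IsPseudoinverse (laplacian G) X → IsPseudoinverse (laplacian Ĝ) Xhat →
  IsPseudoinverse (laplacian G₂) X₂ → IsPseudoinverse (laplacian Ĝ₂) X₂hat →
  let A = moment Ĝ₂ X₂hat v₂ - moment G₂ X₂ v₂
      B = kemeny Ĝ₂ X₂hat - moment G₂ X₂ v₂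
      C = kemeny Ĝ₂ X₂hat - kemeny G₂ X₂
  in
  0ℚ < ((A * (m₁ * m₁) + ((A + C) * m₂ + B * l) * m₁) + C * (m₂ * m₂ + l * m₂)) →
  kemeny G X < kemeny Ĝ Xhat
corollary4p3 {n₁} {k} G₁ v₁ G₂ v₂ s₁ s₂ c₁ c₂ m₁≥1 m₂≥1 𝓛 s𝓛 𝓛-new =
  AddEdges.kemeny-increases s₁ s₂ s𝓛 sG c₁ c₂ os 𝓛-new-in-G₂ m₁≥1 m₂≥1
  where
  open OneSum v₁ v₂
  sG : IsSimple (oneSum G₁ v₁ G₂ v₂)
  sG = addEdges-simple (liftAdj-simple G₁ from₁ s₁) (liftAdj-simple G₂ (from₂ v₁ v₂) s₂)
  os : IsOneSum G₁ G₂ (oneSum G₁ v₁ G₂ v₂)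
  os = oneSum-isOneSum s₁ s₂
  𝓛-new-in-G₂ : ∀ {b b′} → 𝓛 b b′ ≡ true → G₂ b b′ ≡ false
  𝓛-new-in-G₂ {b} {b′} 𝓛bb′ =
    trans (sym (IsOneSum.right os b b′)) (𝓛-new (ι₂ b) (ι₂ b′) b b′ (from₂-ι₂ b) (from₂-ι₂ b′) 𝓛bb′)
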